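{- Let $n\ge2$, let $\lambda$ be a nonzero $n$-partition with $\lambda_n=0$, let $T$ be an $n$-semistandard tableau of shape $\lambda$, let $w^1\le\dots\le w^{\lambda_1}$ be the minimal defining chain for $T$, and let $\pi^{(j,i)}$ be the permutations produced by the greedy procedure applied to $T$. Then $w^j=\pi^{(j,1)}$ for $1\le j\le\lambda_1$.
   Context: Partitions and tableaux. An $n$-partition is $\lambda=(\lambda_1\ge\dots\ge\lambda_n\ge 0)$; its Young diagram has $\lambda_i$ left-justified boxes in row $i$; $c_j$ is the length of column $j$. Location $(j,i)$ means column $j$, row $i$. Reading order: $(l,k)\le(j,i)$ iff $l<j$, or $l=j$ and $k\ge i$. An $n$-semistandard tableau $T$ of shape $\lambda$ fills the boxes with values in $[n]$, weakly increasing along rows, strictly increasing down columns; $T(j,i)$ is the entry at $(j,i)$ and $C_j$ is column $j$. Defining chains. Permutations are in one-line form $(\phi_1,\dots,\phi_n)$. A defining chain for $T$ is a sequence $w^1\le\dots\le w^{\lambda_1}$ in the Bruhat order of $S_n$ such that for each $j$ the set $\{w^j_1,\dots,w^j_{c_j}\}$ equals the set of entries of $C_j$. A minimal defining chain is a defining chain $\{w^j\}$ such that $w^j\le v^j$ (Bruhat) for all $j$ and every defining chain $\{v^j\}$; it is known (Deodhar) that one exists, and it is then unique. Greedy procedure. Permutations $\pi^{(j,i)}$ are produced for $(1,1)$ and all $(j,i)$ with $j\ge2$, in reading order. $\pi^{(1,1)}$ has first $c_1$ entries those of $C_1$ (increasing), then the rest of $[n]$ (increasing). For $j\ge2$, the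 predecessor of $(j,i)$ is $(j,i+1)$ if $i<c_j$ and $(j-1,1)$ if $i=c_j$; let $\pi$ be the permutation at the predecessor. If $T(j-1,i)=T(j,i)$, $\pi^{(j,i)}=\pi$. Otherwise $i_0:=i$, $i_1$ is the smallest index $>c_j$ with $\pi_{i_0}<\pi_{i_1}\le T(j,i)$, and repeatedly $i_x$ is the smallest index with $\pi_{i_{x-1}}<\pi_{i_x}\le T(j,i)$ until $\pi_{i_m}=T(j,i)$; then $\pi^{(j,i)}_{i_x}:=\pi_{i_{x-1}}$ ($1\le x\le m$), $\pi^{(j,i)}_{i_0}:=\pi_{i_m}$, other entries unchanged. -}

module Defs where

open import Data.Nat using (ℕ; zero; suc; _+_; _∸_; _≤_; _<_; _<ᵇ_; _≤ᵇ_; _≡ᵇ_)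
open import Data.Bool using (Bool; true; false; _∧_; if_then_else_; not)
open import Data.List using (List; []; _∷_; _++_; map; length; applyUpTo; filterᵇ; reverse)
open import Data.Bool.ListAction using (any)
open import Data.Maybe using (Maybe; just; nothing; _>>=_)
open import Data.Product using (Σ; _×_; _,_)
open import Relation.Binary.PropositionalEquality using (_≡_)
open import Relation.Binary.Construct.Closure.ReflexiveTransitive using (Star)
open import Data.List.Membership.Propositional using (_∈_)
open import Data.List.Relation.Binary.Permutation.Propositional using (_↭_)

-- Conventions: everything is 1-indexed as in the paper.
-- A permutation in one-line form is a List ℕ; positions and values start at 1.

range : ℕ → ℕ → List ℕ
range a b = applyUpTo (a +_) (suc b ∸ a)

-- entry at (1-indexed) position p; 0 if out of range
at : List ℕ → ℕ → ℕ
at []       _             = 0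
at (x ∷ xs) zero          = 0
at (x ∷ xs) (suc zero)    = x
at (x ∷ xs) (suc (suc k)) = at xs (suc k)

setAt : List ℕ → ℕ → ℕ → List ℕ
setAt []       _             v = []
setAt (x ∷ xs) zero          v = x ∷ xs
setAt (x ∷ xs) (suc zero)    v = v ∷ xs
setAt (x ∷ xs) (suc (suc k)) v = x ∷ setAt xs (suc k) v

take : ℕ → List ℕ → List ℕ
take zero    _        = []
take (suc k) []       = []
take (suc k) (x ∷ xs) = x ∷ take k xs

IsPerm : ℕ → List ℕ → Set
IsPerm n w = w ↭ range 1 n

swapAt : List ℕ → ℕ → ℕ → List ℕ
swapAt u a b = setAt (setAt u a (at u b)) b (at u a)

-- u < u·(a b) whenever a < b and u_a < u_b (length goes up)
data BruhatStep (u : List ℕ) : List ℕ → Set where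
  step : (a b : ℕ) → 1 ≤ a → a < b → b ≤ length u → at u a < at u b →
         BruhatStep u (swapAt u a b)

_≤B_ : List ℕ → List ℕ → Set
u ≤B v = Star BruhatStep u v

-- Partitions and tableaux.  A partition is lam : ℕ → ℕ, only lam 1 .. lam n matter.
-- A filling is T : ℕ → ℕ → ℕ, T j i = entry in column j, row i (only boxes matter).

IsPartition : ℕ → (ℕ → ℕ) → Set
IsPartition n lam = ∀ i → 1 ≤ i → i < n → lam (suc i) ≤ lam i

InShape : ℕ → (ℕ → ℕ) → ℕ → ℕ → Set
InShape n lam j i = 1 ≤ i × i ≤ n × 1 ≤ j × j ≤ lam i

IsSSYT : ℕ → (ℕ → ℕ) → (ℕ → ℕ → ℕ) → Set
IsSSYT n lam T =
    (∀ j i → InShape n lam j i → 1 ≤ T j i × T j i ≤ n)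
  × (∀ j i → InShape n lam j i → InShape n lam (suc j) i → T j i ≤ T (suc j) i)
  × (∀ j i → InShape n lam j i → InShape n lam j (suc i) → T j i < T j (suc i))

colLen : ℕ → (ℕ → ℕ) → ℕ → ℕ
colLen n lam j = length (filterᵇ (λ i → j ≤ᵇ lam i) (range 1 n))

column : ℕ → (ℕ → ℕ) → (ℕ → ℕ → ℕ) → ℕ → List ℕ
column n lam T j = map (T j) (range 1 (colLen n lam j))

SameSet : List ℕ → List ℕ → Set
SameSet xs ys = ∀ x → (x ∈ xs → x ∈ ys) × (x ∈ ys → x ∈ xs)

-- Defining chains (w : ℕ → List ℕ, w j = w^j for 1 ≤ j ≤ λ_1)

IsDefiningChain : ℕ → (ℕ → ℕ) → (ℕ → ℕ → ℕ) → (ℕ → List ℕ) → Set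
IsDefiningChain n lam T w =
    (∀ j → 1 ≤ j → j ≤ lam 1 → IsPerm n (w j))
  × (∀ j → 1 ≤ j → j < lam 1 → w j ≤B w (suc j))
  × (∀ j → 1 ≤ j → j ≤ lam 1 →
       SameSet (take (colLen n lam j) (w j)) (column n lam T j))

IsMinimalDefiningChain : ℕ → (ℕ → ℕ) → (ℕ → ℕ → ℕ) → (ℕ → List ℕ) → Set
IsMinimalDefiningChain n lam T w =
    IsDefiningChain n lam T w
  × (∀ v → IsDefiningChain n lam T v → ∀ j → 1 ≤ j → j ≤ lam 1 → w j ≤B v j)

-- Greedy procedure.  Partiality (a required index not existing) is
-- recorded by 'nothing'.

findFirst : (ℕ → Bool) → List ℕ → Maybe ℕ
findFirst p []       = nothing
findFirst p (x ∷ xs) = if p x then just x else findFirst p xs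

pi11 : ℕ → (ℕ → ℕ) → (ℕ → ℕ → ℕ) → List ℕ
pi11 n lam T =
  column n lam T 1 ++
  filterᵇ (λ x → not (any (λ y → x ≡ᵇ y) (column n lam T 1))) (range 1 n)

-- given current index cur, produce i_{x+1}, ..., i_m (fuel bounds the length)
chase : ℕ → ℕ → List ℕ → ℕ → ℕ → Maybe (List ℕ)
chase n zero    π t cur = nothing
chase n (suc f) π t cur =
  if at π cur ≡ᵇ t then just []
  else (findFirst (λ p → (at π cur <ᵇ at π p) ∧ (at π p ≤ᵇ t)) (range 1 n) >>= λ p →
        chase n f π t p >>= λ rest → just (p ∷ rest))

-- right rotation [a0,...,am] ↦ [am,a0,...,a(m-1)]
rotR : List ℕ → List ℕ
rotR xs with reverse xs
... | []     = []
... | y ∷ ys = y ∷ reverse ys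

setMany : List ℕ → List ℕ → List ℕ → List ℕ
setMany π []       _        = π
setMany π (_ ∷ _)  []       = π
setMany π (p ∷ ps) (v ∷ vs) = setMany (setAt π p v) ps vs

greedyStep : ℕ → (ℕ → ℕ) → (ℕ → ℕ → ℕ) → ℕ → ℕ → List ℕ → Maybe (List ℕ)
greedyStep n lam T j i π =
  if T (j ∸ 1) i ≡ᵇ T j i then just π
  else (findFirst (λ p → (at π i <ᵇ at π p) ∧ (at π p ≤ᵇ T j i))
                  (range (suc (colLen n lam j)) n) >>= λ i₁ →
        chase n n π (T j i) i₁ >>= λ rest →
        let idx = i ∷ i₁ ∷ rest in
        just (setMany π idx (rotR (map (at π) idx))))

runRows : ℕ → (ℕ → ℕ) → (ℕ → ℕ → ℕ) → ℕ → List ℕ → List ℕ → Maybe (List ℕ)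
runRows n lam T j []       π = just π
runRows n lam T j (i ∷ is) π = greedyStep n lam T j i π >>= runRows n lam T j is

-- greedyPi n lam T j i = pi^(j,i)  (for j = 1 only i = 1 is meaningful)
greedyPi : ℕ → (ℕ → ℕ) → (ℕ → ℕ → ℕ) → ℕ → ℕ → Maybe (List ℕ)
greedyPi n lam T zero          i = nothing
greedyPi n lam T (suc zero)    i = just (pi11 n lam T)
greedyPi n lam T (suc (suc k)) i =
  greedyPi n lam T (suc k) 1 >>=
  runRows n lam T (suc (suc k)) (reverse (range i (colLen n lam (suc (suc k)))))

module Submission where

-- Order-theoretic tool: for a list u write  exceed u k s  for the number of
-- entries among the first k entries of u that are larger than s, and
-- u ≼ v  for  exceed u k s ≤ exceed v k s  for all k, s  (the tableau
-- criterion).  A Bruhat step only increases these counts, so u ≤B v implies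
-- u ≼ v, and ≼ is antisymmetric on lists of equal length.
--
-- Plan.  (1) Every greedy step π ↦ π' is a composite of Bruhat steps (the
-- cyclic rotation along the chain i₀ < i₁ < … < i_m is the product of the
-- transpositions (i₀ i₁), (i₁ i₂), …), so the greedy permutations form a
-- defining chain P.  (2) Column by column, every permutation X whose first
-- c_j entries are the entries of C_j and with π ≼ X satisfies π' ≼ X: the
-- new permutation is "as small as possible" given the new column.  For the
-- first column this holds because π^(1,1) lists both blocks increasingly.
-- (3) For the minimal chain w we get w ≼ P by minimality and P ≼ w by (2)
-- and induction on j, hence w = P by antisymmetry.

open import Defs hiding (take)
open import Defs using () renaming (take to takeᴰ)
open import Data.Nat
open import Data.Nat.Properties
open import Data.Nat.ListAction using (sum)
open import Data.Nat.ListAction.Properties using (sum-↭)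
open import Data.Bool using (Bool; true; false; _∧_; not; if_then_else_) renaming (T to True)
open import Data.Bool.Properties using (T-∧; T-not-≡)
open import Data.Bool.ListAction using (any)
open import Data.Maybe using (Maybe; just; _>>=_; fromMaybe)
open import Data.List using (List; []; _∷_; _++_; _∷ʳ_; map; length; take; drop; applyUpTo; applyDownFrom; filterᵇ; reverse)
open import Data.List.Properties
  using (length-map; take++drop≡id; length-drop; take-all; take-take; length-applyUpTo;
         map-applyUpTo; reverse-applyUpTo; length-filter; unfold-reverse; reverse-involutive)
open import Data.List.Relation.Unary.All as All using (All; []; _∷_)
open import Data.List.Relation.Unary.Any as Any using (here; there)
open import Data.List.Relation.Unary.Any.Properties using (any⁺; any⁻)
open import Data.List.Relation.Unary.AllPairs as AllPairs using (AllPairs; []; _∷_)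
import Data.List.Relation.Unary.AllPairs.Properties as AllPairsₚ
open import Data.List.Relation.Unary.Unique.Propositional using (Unique)
open import Data.List.Membership.Propositional using (_∈_; _∉_)
open import Data.List.Relation.Binary.Subset.Propositional using (_⊆_)
open import Data.List.Membership.Propositional.Properties
  using (∈-++⁺ˡ; ∈-++⁺ʳ; ∈-++⁻; ∈-∃++; ∈-applyUpTo⁺; ∈-filter⁺; ∈-filter⁻)
open import Data.List.Relation.Binary.Permutation.Propositional
  using (_↭_; ↭-refl; ↭-sym; ↭-trans; ↭-prep; ↭-swap; ↭⇒↭ₛ)
open import Data.List.Relation.Binary.Permutation.Propositional.Properties
  using (∈-resp-↭; ↭-length; shift; map⁺)
import Data.List.Relation.Binary.Permutation.Setoid.Properties as PermSetoid
open import Data.Product using (Σ; _×_; _,_; proj₁; proj₂)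
open import Data.Sum using (_⊎_; inj₁; inj₂; [_,_]′)
open import Data.Unit using (⊤; tt)
open import Data.Empty using (⊥; ⊥-elim)
open import Function using (_∘_)
open import Relation.Nullary using (¬_; yes; no)
open import Relation.Nullary.Decidable using (T?)
open import Function.Bundles using (Equivalence)
open import Relation.Binary.PropositionalEquality
open import Relation.Binary.Construct.Closure.ReflexiveTransitive using (ε; _◅_; _◅◅_)

-- Positional editing.  'at' and 'setAt' are 1-indexed; position 0 and
-- positions beyond the end are inert.

length-setAt : ∀ u p v → length (setAt u p v) ≡ length u
length-setAt []      p             v = refl
length-setAt (x ∷ u) zero          v = refl
length-setAt (x ∷ u) (suc zero)    v = refl
length-setAt (x ∷ u) (suc (suc p)) v = cong suc (length-setAt u (suc p) v)

length-swapAt : ∀ u a b → length (swapAt u a b) ≡ length u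
length-swapAt u a b = trans (length-setAt (setAt u a (at u b)) b (at u a)) (length-setAt u a (at u b))

at-setAt-≡ : ∀ u p v → 1 ≤ p → p ≤ length u → at (setAt u p v) p ≡ v
at-setAt-≡ []      p             v 1≤p p≤ with () ← ≤-trans 1≤p p≤
at-setAt-≡ (x ∷ u) (suc zero)    v 1≤p p≤ = refl
at-setAt-≡ (x ∷ u) (suc (suc p)) v 1≤p (s≤s p≤) = at-setAt-≡ u (suc p) v (s≤s z≤n) p≤

at-setAt-≢ : ∀ u p q v → p ≢ q → at (setAt u p v) q ≡ at u q
at-setAt-≢ []      p             q             v p≢q = refl
at-setAt-≢ (x ∷ u) zero          q             v p≢q = refl
at-setAt-≢ (x ∷ u) (suc zero)    zero          v p≢q = refl
at-setAt-≢ (x ∷ u) (suc zero)    (suc zero)    v p≢q = ⊥-elim (p≢q refl)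
at-setAt-≢ (x ∷ u) (suc zero)    (suc (suc q)) v p≢q = refl
at-setAt-≢ (x ∷ u) (suc (suc p)) zero          v p≢q = refl
at-setAt-≢ (x ∷ u) (suc (suc p)) (suc zero)    v p≢q = refl
at-setAt-≢ (x ∷ u) (suc (suc p)) (suc (suc q)) v p≢q =
  at-setAt-≢ u (suc p) (suc q) v (p≢q ∘ cong suc)

setAt-comm : ∀ u p q a b → p ≢ q → setAt (setAt u p a) q b ≡ setAt (setAt u q b) p a
setAt-comm []      p             q             a b p≢q = refl
setAt-comm (x ∷ u) zero          zero          a b p≢q = refl
setAt-comm (x ∷ u) zero          (suc zero)    a b p≢q = refl
setAt-comm (x ∷ u) zero          (suc (suc q)) a b p≢q = refl
setAt-comm (x ∷ u) (suc zero)    zero          a b p≢q = refl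
setAt-comm (x ∷ u) (suc zero)    (suc zero)    a b p≢q = ⊥-elim (p≢q refl)
setAt-comm (x ∷ u) (suc zero)    (suc (suc q)) a b p≢q = refl
setAt-comm (x ∷ u) (suc (suc p)) zero          a b p≢q = refl
setAt-comm (x ∷ u) (suc (suc p)) (suc zero)    a b p≢q = refl
setAt-comm (x ∷ u) (suc (suc p)) (suc (suc q)) a b p≢q =
  cong (x ∷_) (setAt-comm u (suc p) (suc q) a b (p≢q ∘ cong suc))

setAt-idem : ∀ u p a b → setAt (setAt u p a) p b ≡ setAt u p b
setAt-idem []      p             a b = refl
setAt-idem (x ∷ u) zero          a b = refl
setAt-idem (x ∷ u) (suc zero)    a b = refl
setAt-idem (x ∷ u) (suc (suc p)) a b = cong (x ∷_) (setAt-idem u (suc p) a b)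

setAt-at : ∀ u p → setAt u p (at u p) ≡ u
setAt-at []      p             = refl
setAt-at (x ∷ u) zero          = refl
setAt-at (x ∷ u) (suc zero)    = refl
setAt-at (x ∷ u) (suc (suc p)) = cong (x ∷_) (setAt-at u (suc p))

setAt-↭ : ∀ xs q x → 1 ≤ q → q ≤ length xs → (at xs q ∷ setAt xs q x) ↭ (x ∷ xs)
setAt-↭ []       q             x 1≤q q≤ with () ← ≤-trans 1≤q q≤
setAt-↭ (z ∷ zs) (suc zero)    x 1≤q q≤ = ↭-swap z x ↭-refl
setAt-↭ (z ∷ zs) (suc (suc q)) x 1≤q (s≤s q≤) =
  ↭-trans (↭-swap (at zs (suc q)) z ↭-refl)
    (↭-trans (↭-prep z (setAt-↭ zs (suc q) x (s≤s z≤n) q≤)) (↭-swap z x ↭-refl))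

swapAt-↭ : ∀ u a b → 1 ≤ a → a < b → b ≤ length u → swapAt u a b ↭ u
swapAt-↭ []       a             b             1≤a a<b b≤ with () ← ≤-trans (≤-trans 1≤a (<⇒≤ a<b)) b≤
swapAt-↭ (x ∷ xs) (suc zero)    (suc zero)    1≤a (s≤s ()) b≤
swapAt-↭ (x ∷ xs) (suc zero)    (suc (suc b)) 1≤a a<b (s≤s b≤) = setAt-↭ xs (suc b) x (s≤s z≤n) b≤
swapAt-↭ (x ∷ xs) (suc (suc a)) (suc zero)    1≤a (s≤s ()) b≤
swapAt-↭ (x ∷ xs) (suc (suc a)) (suc (suc b)) 1≤a (s≤s a<b) (s≤s b≤) =
  ↭-prep x (swapAt-↭ xs (suc a) (suc b) (s≤s z≤n) a<b b≤)

at-∈ : ∀ u p → 1 ≤ p → p ≤ length u → at u p ∈ u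
at-∈ []      p             1≤p p≤ with () ← ≤-trans 1≤p p≤
at-∈ (x ∷ u) (suc zero)    1≤p p≤ = here refl
at-∈ (x ∷ u) (suc (suc p)) 1≤p (s≤s p≤) = there (at-∈ u (suc p) (s≤s z≤n) p≤)

∈⇒at : ∀ u {x} → x ∈ u → Σ ℕ λ p → 1 ≤ p × p ≤ length u × at u p ≡ x
∈⇒at (y ∷ u) (here refl) = 1 , ≤-refl , s≤s z≤n , refl
∈⇒at (y ∷ u) (there x∈u) with ∈⇒at u x∈u
... | suc p , _ , p≤ , e = suc (suc p) , s≤s z≤n , s≤s p≤ , e

at-take : ∀ k u p → p ≤ k → at (take k u) p ≡ at u p
at-take zero    []      p             p≤k = refl
at-take (suc k) []      p             p≤k = refl
at-take zero    (x ∷ u) zero          p≤k = refl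
at-take (suc k) (x ∷ u) zero          p≤k = refl
at-take (suc k) (x ∷ u) (suc zero)    p≤k = refl
at-take (suc k) (x ∷ u) (suc (suc p)) (s≤s p≤k) = at-take k u (suc p) p≤k

at-map : ∀ f u p → 1 ≤ p → p ≤ length u → at (map f u) p ≡ f (at u p)
at-map f []      p             1≤p p≤ with () ← ≤-trans 1≤p p≤
at-map f (x ∷ u) (suc zero)    1≤p p≤ = refl
at-map f (x ∷ u) (suc (suc p)) 1≤p (s≤s p≤) = at-map f u (suc p) (s≤s z≤n) p≤

at-++ˡ : ∀ xs ys p → p ≤ length xs → at (xs ++ ys) p ≡ at xs p
at-++ˡ []       []       zero          p≤ = refl
at-++ˡ []       (y ∷ ys) zero          p≤ = refl
at-++ˡ (x ∷ xs) ys       zero          p≤ = refl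
at-++ˡ (x ∷ xs) ys       (suc zero)    p≤ = refl
at-++ˡ (x ∷ xs) ys       (suc (suc p)) (s≤s p≤) = at-++ˡ xs ys (suc p) p≤

list-ext : ∀ u v → length u ≡ length v → (∀ p → 1 ≤ p → p ≤ length u → at u p ≡ at v p) → u ≡ v
list-ext []      []      _   _    = refl
list-ext (x ∷ u) (y ∷ v) len same = cong₂ _∷_ (same 1 ≤-refl (s≤s z≤n))
  (list-ext u v (suc-injective len) λ { (suc p) _ p≤ → same (suc (suc p)) (s≤s z≤n) (s≤s p≤) })

takeᴰ≡take : ∀ k (u : List ℕ) → takeᴰ k u ≡ take k u
takeᴰ≡take zero    u       = refl
takeᴰ≡take (suc k) []      = refl
takeᴰ≡take (suc k) (x ∷ u) = cong (x ∷_) (takeᴰ≡take k u)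

length-take≤ : ∀ k (u : List ℕ) → length (take k u) ≤ k
length-take≤ zero    u       = z≤n
length-take≤ (suc k) []      = z≤n
length-take≤ (suc k) (x ∷ u) = s≤s (length-take≤ k u)

length-take≡ : ∀ k (u : List ℕ) → k ≤ length u → length (take k u) ≡ k
length-take≡ zero    u       _        = refl
length-take≡ (suc k) (x ∷ u) (s≤s k≤) = cong suc (length-take≡ k u k≤)

∈-drop : ∀ k (u : List ℕ) {y} → y ∈ drop k u → y ∈ u
∈-drop k u m = subst (_ ∈_) (take++drop≡id k u) (∈-++⁺ʳ (take k u) m)

take-++ˡ : ∀ k (xs ys : List ℕ) → k ≤ length xs → take k (xs ++ ys) ≡ take k xs
take-++ˡ zero    xs       ys _        = refl
take-++ˡ (suc k) (x ∷ xs) ys (s≤s k≤) = cong (x ∷_) (take-++ˡ k xs ys k≤)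

drop-++ˡ : ∀ (xs ys : List ℕ) → drop (length xs) (xs ++ ys) ≡ ys
drop-++ˡ []       ys = refl
drop-++ˡ (x ∷ xs) ys = drop-++ˡ xs ys

-- Counting entries above a threshold, and the dominance order.

above : ℕ → ℕ → ℕ
above s x with s <? x
... | yes _ = 1
... | no  _ = 0

atMost : ℕ → ℕ → ℕ
atMost s x with x ≤? s
... | yes _ = 1
... | no  _ = 0

above-yes : ∀ {s x} → s < x → above s x ≡ 1
above-yes {s} {x} s<x with s <? x
... | yes _   = refl
... | no  s≮x = ⊥-elim (s≮x s<x)

above-no : ∀ {s x} → x ≤ s → above s x ≡ 0
above-no {s} {x} x≤s with s <? x
... | yes s<x = ⊥-elim (<⇒≱ s<x x≤s)
... | no  _   = refl

atMost-yes : ∀ {s x} → x ≤ s → atMost s x ≡ 1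
atMost-yes {s} {x} x≤s with x ≤? s
... | yes _   = refl
... | no  x≰s = ⊥-elim (x≰s x≤s)

atMost-no : ∀ {s x} → s < x → atMost s x ≡ 0
atMost-no {s} {x} s<x with x ≤? s
... | yes x≤s = ⊥-elim (<⇒≱ s<x x≤s)
... | no  _   = refl

above+atMost : ∀ s x → above s x + atMost s x ≡ 1
above+atMost s x with ≤-<-connex x s
... | inj₁ x≤s = subst₂ (λ a b → a + b ≡ 1) (sym (above-no x≤s)) (sym (atMost-yes x≤s)) refl
... | inj₂ s<x = subst₂ (λ a b → a + b ≡ 1) (sym (above-yes s<x)) (sym (atMost-no s<x)) refl

above≤1 : ∀ s x → above s x ≤ 1
above≤1 s x with ≤-<-connex x s
... | inj₁ x≤s = subst (_≤ 1) (sym (above-no x≤s)) z≤n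
... | inj₂ s<x = ≤-reflexive (above-yes s<x)

above-monoʳ : ∀ s {x y} → x ≤ y → above s x ≤ above s y
above-monoʳ s {x} {y} x≤y with ≤-<-connex x s
... | inj₁ x≤s = subst (_≤ above s y) (sym (above-no x≤s)) z≤n
... | inj₂ s<x = ≤-trans (≤-reflexive (above-yes s<x)) (≤-reflexive (sym (above-yes (<-≤-trans s<x x≤y))))

above-antiˡ : ∀ x {s t} → s ≤ t → above t x ≤ above s x
above-antiˡ x {s} {t} s≤t with ≤-<-connex x t
... | inj₁ x≤t = subst (_≤ above s x) (sym (above-no x≤t)) z≤n
... | inj₂ t<x = ≤-trans (≤-reflexive (above-yes t<x)) (≤-reflexive (sym (above-yes (≤-<-trans s≤t t<x))))

above-injective : ∀ x y → (∀ s → above s x ≡ above s y) → x ≡ y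
above-injective x y same = ≤-antisym (lemma x y same) (lemma y x (sym ∘ same))
  where
    lemma : ∀ x y → (∀ s → above s x ≡ above s y) → x ≤ y
    lemma x y same with ≤-<-connex x y
    ... | inj₁ x≤y = x≤y
    ... | inj₂ y<x = ⊥-elim (0≢1+n (trans (sym (above-no {y} {y} ≤-refl)) (trans (sym (same y)) (above-yes y<x))))

count : (ℕ → ℕ) → List ℕ → ℕ
count f xs = sum (map f xs)

count-↭ : ∀ f {xs ys} → xs ↭ ys → count f xs ≡ count f ys
count-↭ f p = sum-↭ (map⁺ f p)

exceed : List ℕ → ℕ → ℕ → ℕ
exceed u k s = count (above s) (take k u)

-- the tableau criterion for the Bruhat order
_≼_ : List ℕ → List ℕ → Set
u ≼ v = ∀ k s → exceed u k s ≤ exceed v k s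

≼-reflexive : ∀ {u v} → u ≡ v → u ≼ v
≼-reflexive refl k s = ≤-refl

≼-trans : ∀ {u v w} → u ≼ v → v ≼ w → u ≼ w
≼-trans u≼v v≼w k s = ≤-trans (u≼v k s) (v≼w k s)

exceed-[] : ∀ k s → exceed [] k s ≡ 0
exceed-[] zero    s = refl
exceed-[] (suc k) s = refl

exceed≤k : ∀ u k s → exceed u k s ≤ k
exceed≤k u       zero    s = z≤n
exceed≤k []      (suc k) s = z≤n
exceed≤k (x ∷ u) (suc k) s = +-mono-≤ (above≤1 s x) (exceed≤k u k s)

inPrefix : ℕ → ℕ → ℕ → ℕ
inPrefix zero    k       x = x
inPrefix (suc p) zero    x = 0
inPrefix (suc p) (suc k) x = inPrefix p k x

inPrefix-yes : ∀ p k x → p ≤ k → inPrefix p k x ≡ x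
inPrefix-yes zero    k       x _         = refl
inPrefix-yes (suc p) (suc k) x (s≤s p≤k) = inPrefix-yes p k x p≤k

inPrefix-no : ∀ p k x → k < p → inPrefix p k x ≡ 0
inPrefix-no (suc p) zero    x _         = refl
inPrefix-no (suc p) (suc k) x (s≤s k<p) = inPrefix-no p k x k<p

+-exchange : ∀ a b c → a + b + c ≡ c + b + a
+-exchange a b c = begin
  a + b + c   ≡⟨ +-comm (a + b) c ⟩
  c + (a + b) ≡⟨ cong (c +_) (+-comm a b) ⟩
  c + (b + a) ≡⟨ sym (+-assoc c b a) ⟩
  c + b + a   ∎
  where open ≡-Reasoning

exceed-setAt : ∀ u p v k s → 1 ≤ p → p ≤ length u →
  exceed (setAt u p v) k s + inPrefix p k (above s (at u p)) ≡ exceed u k s + inPrefix p k (above s v)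
exceed-setAt []      p             v k       s 1≤p p≤ with () ← ≤-trans 1≤p p≤
exceed-setAt (x ∷ u) (suc zero)    v zero    s 1≤p p≤ = refl
exceed-setAt (x ∷ u) (suc zero)    v (suc k) s 1≤p p≤ =
  +-exchange (above s v) (exceed u k s) (above s x)
exceed-setAt (x ∷ u) (suc (suc p)) v zero    s 1≤p p≤ = refl
exceed-setAt (x ∷ u) (suc (suc p)) v (suc k) s 1≤p (s≤s p≤) =
  trans (+-assoc (above s x) _ _)
    (trans (cong (above s x +_) (exceed-setAt u (suc p) v k s (s≤s z≤n) p≤)) (sym (+-assoc (above s x) _ _)))

-- The effect of a transposition on the counts: only prefixes that separate
-- the two swapped positions change, by the difference of their indicators.
module SwapCount (u : List ℕ) (a b k s : ℕ) (1≤a : 1 ≤ a) (a<b : a < b) (b≤len : b ≤ length u) where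
  private
    ua = at u a
    ub = at u b
    u₁ = setAt u a ub
    swapped = swapAt u a b

    after-first-write : exceed u₁ k s + inPrefix a k (above s ua) ≡ exceed u k s + inPrefix a k (above s ub)
    after-first-write = exceed-setAt u a ub k s 1≤a (≤-trans (<⇒≤ a<b) b≤len)

    after-second-write : exceed swapped k s + inPrefix b k (above s ub) ≡ exceed u₁ k s + inPrefix b k (above s ua)
    after-second-write =
      subst (λ z → exceed swapped k s + inPrefix b k (above s z) ≡ exceed u₁ k s + inPrefix b k (above s ua))
            (at-setAt-≢ u a b ub (<⇒≢ a<b))
            (exceed-setAt u₁ b ua k s (≤-trans 1≤a (<⇒≤ a<b)) (subst (b ≤_) (sym (length-setAt u a ub)) b≤len))

    FirstEq SecondEq : ℕ → ℕ → Set
    FirstEq  α β = exceed u₁ k s + α ≡ exceed u k s + β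
    SecondEq α β = exceed swapped k s + α ≡ exceed u₁ k s + β

  exceed-swap : exceed swapped k s ≡ exceed u k s ⊎
                (a ≤ k × k < b × exceed swapped k s + above s ua ≡ exceed u k s + above s ub)
  exceed-swap with ≤-<-connex a k
  ... | inj₂ k<a = inj₁ (trans (+-cancelʳ-≡ 0 _ _ second) (+-cancelʳ-≡ 0 _ _ first))
    where
      first : exceed u₁ k s + 0 ≡ exceed u k s + 0
      first = subst₂ FirstEq (inPrefix-no a k _ k<a) (inPrefix-no a k _ k<a) after-first-write
      second : exceed swapped k s + 0 ≡ exceed u₁ k s + 0
      second = subst₂ SecondEq (inPrefix-no b k _ (<-trans k<a a<b)) (inPrefix-no b k _ (<-trans k<a a<b)) after-second-write
  ... | inj₁ a≤k with ≤-<-connex b k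
  ...   | inj₂ k<b = inj₂ (a≤k , k<b , trans (cong (_+ above s ua) (+-cancelʳ-≡ 0 _ _ second)) first)
    where
      first : exceed u₁ k s + above s ua ≡ exceed u k s + above s ub
      first = subst₂ FirstEq (inPrefix-yes a k _ a≤k) (inPrefix-yes a k _ a≤k) after-first-write
      second : exceed swapped k s + 0 ≡ exceed u₁ k s + 0
      second = subst₂ SecondEq (inPrefix-no b k _ k<b) (inPrefix-no b k _ k<b) after-second-write
  ...   | inj₁ b≤k = inj₁ (+-cancelʳ-≡ (above s ub) _ _ (trans second first))
    where
      first : exceed u₁ k s + above s ua ≡ exceed u k s + above s ub
      first = subst₂ FirstEq (inPrefix-yes a k _ a≤k) (inPrefix-yes a k _ a≤k) after-first-write
      second : exceed swapped k s + above s ub ≡ exceed u₁ k s + above s ua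
      second = subst₂ SecondEq (inPrefix-yes b k _ b≤k) (inPrefix-yes b k _ b≤k) after-second-write

  swap-increases : ua < ub → exceed u k s ≤ exceed swapped k s
  swap-increases ua<ub with exceed-swap
  ... | inj₁ same = ≤-reflexive (sym same)
  ... | inj₂ (_ , _ , eq) = +-cancelʳ-≤ (above s ub) _ _
          (subst (_≤ exceed swapped k s + above s ub) eq
                 (+-monoʳ-≤ (exceed swapped k s) (above-monoʳ s (<⇒≤ ua<ub))))

  -- the count after the swap stays below that of X, provided it did before
  -- and it was strictly below in the one situation where the swap raises it
  -- (the prefix separates a and b, and s lies in [u_a, u_b))
  swap-stays-below : ∀ X → exceed u k s ≤ exceed X k s →
    (a ≤ k → k < b → ua ≤ s → s < ub → exceed u k s < exceed X k s) →
    ua < ub → exceed swapped k s ≤ exceed X k s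
  swap-stays-below X below strict ua<ub with exceed-swap
  ... | inj₁ same = subst (_≤ exceed X k s) (sym same) below
  ... | inj₂ (a≤k , k<b , eq) with ≤-<-connex ua s | ≤-<-connex ub s
  ...   | inj₂ s<ua | _ = subst (_≤ exceed X k s) (sym (+-cancelʳ-≡ 1 _ _ eq₁)) below
    where eq₁ : exceed swapped k s + 1 ≡ exceed u k s + 1
          eq₁ = subst₂ (λ α β → exceed swapped k s + α ≡ exceed u k s + β)
                       (above-yes s<ua) (above-yes (<-trans s<ua ua<ub)) eq
  ...   | inj₁ ua≤s | inj₂ s<ub = subst (_≤ exceed X k s) (sym eq₁) (strict a≤k k<b ua≤s s<ub)
    where eq₁ : exceed swapped k s ≡ suc (exceed u k s)
          eq₁ = trans (sym (+-identityʳ _))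
                  (trans (subst₂ (λ α β → exceed swapped k s + α ≡ exceed u k s + β)
                                 (above-no ua≤s) (above-yes s<ub) eq)
                         (+-comm (exceed u k s) 1))
  ...   | inj₁ ua≤s | inj₁ ub≤s = subst (_≤ exceed X k s) (sym (+-cancelʳ-≡ 0 _ _ eq₁)) below
    where eq₁ : exceed swapped k s + 0 ≡ exceed u k s + 0
          eq₁ = subst₂ (λ α β → exceed swapped k s + α ≡ exceed u k s + β) (above-no ua≤s) (above-no ub≤s) eq

≤B⇒≼ : ∀ {u v} → u ≤B v → u ≼ v
≤B⇒≼ ε                                      k s = ≤-refl
≤B⇒≼ (step a b 1≤a a<b b≤len ua<ub ◅ steps) k s =
  ≤-trans (SwapCount.swap-increases _ a b k s 1≤a a<b b≤len ua<ub) (≤B⇒≼ steps k s)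

exceed-injective : ∀ u v → (∀ k s → exceed u k s ≡ exceed v k s) → length u ≡ length v → u ≡ v
exceed-injective []      []      _    _   = refl
exceed-injective (x ∷ u) (y ∷ v) same len = cong₂ _∷_ x≡y (exceed-injective u v same-tail (suc-injective len))
  where
    x≡y : x ≡ y
    x≡y = above-injective x y λ s → trans (sym (+-identityʳ _)) (trans (same 1 s) (+-identityʳ _))
    same-tail : ∀ k s → exceed u k s ≡ exceed v k s
    same-tail k s = +-cancelˡ-≡ (above s x) _ _ (trans (same (suc k) s) (cong (λ z → above s z + exceed v k s) (sym x≡y)))

≼-antisym : ∀ u v → u ≼ v → v ≼ u → length u ≡ length v → u ≡ v
≼-antisym u v u≼v v≼u = exceed-injective u v λ k s → ≤-antisym (u≼v k s) (v≼u k s)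

exceed-split : ∀ u c m s → exceed u (c + m) s ≡ exceed u c s + exceed (drop c u) m s
exceed-split u       zero    m s = refl
exceed-split []      (suc c) m s = sym (exceed-[] m s)
exceed-split (x ∷ u) (suc c) m s =
  trans (cong (above s x +_) (exceed-split u c m s)) (sym (+-assoc (above s x) _ _))

exceed+atMost : ∀ u k s → k ≤ length u → exceed u k s + count (atMost s) (take k u) ≡ k
exceed+atMost u       zero    s _        = refl
exceed+atMost (x ∷ u) (suc k) s (s≤s k≤) = begin
  (above s x + exceed u k s) + (atMost s x + L)   ≡⟨ +-assoc (above s x) _ _ ⟩
  above s x + (exceed u k s + (atMost s x + L))   ≡⟨ cong (above s x +_) (sym (+-assoc (exceed u k s) _ _)) ⟩
  above s x + ((exceed u k s + atMost s x) + L)   ≡⟨ cong (λ z → above s x + (z + L)) (+-comm (exceed u k s) _) ⟩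
  above s x + ((atMost s x + exceed u k s) + L)   ≡⟨ cong (above s x +_) (+-assoc (atMost s x) _ _) ⟩
  above s x + (atMost s x + (exceed u k s + L))   ≡⟨ sym (+-assoc (above s x) _ _) ⟩
  (above s x + atMost s x) + (exceed u k s + L)   ≡⟨ cong₂ _+_ (above+atMost s x) (exceed+atMost u k s k≤) ⟩
  suc k                                           ∎
  where open ≡-Reasoning
        L = count (atMost s) (take k u)

count-take≤ : ∀ f k u → count f (take k u) ≤ count f u
count-take≤ f zero    u       = z≤n
count-take≤ f (suc k) []      = z≤n
count-take≤ f (suc k) (x ∷ u) = +-monoʳ-≤ (f x) (count-take≤ f k u)

exceed-full : ∀ u k s → length u ≤ k → exceed u k s ≡ count (above s) u
exceed-full u k s len≤k = cong (count (above s)) (take-all k u len≤k)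

exceed-take : ∀ u k c s → k ≤ c → exceed u k s ≡ exceed (take c u) k s
exceed-take u k c s k≤c = cong (count (above s)) (sym (trans (take-take k c u) (cong (λ z → take z u) (m≤n⇒m⊓n≡m k≤c))))

exceed-agree : ∀ u v k s → (∀ q → 1 ≤ q → q ≤ k → at u q ≡ at v q) → length u ≡ length v →
               exceed u k s ≡ exceed v k s
exceed-agree u       v       zero    s _    _   = refl
exceed-agree []      []      (suc k) s _    _   = refl
exceed-agree (x ∷ u) (y ∷ v) (suc k) s same len =
  cong₂ _+_ (cong (above s) (same 1 ≤-refl (s≤s z≤n)))
            (exceed-agree u v k s (λ { (suc q) _ q≤k → same (suc (suc q)) (s≤s z≤n) (s≤s q≤k) }) (suc-injective len))

exceed-antiʳ : ∀ u k {s t} → s ≤ t → exceed u k t ≤ exceed u k s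
exceed-antiʳ u       zero    s≤t = z≤n
exceed-antiʳ []      (suc k) s≤t = z≤n
exceed-antiʳ (x ∷ u) (suc k) s≤t = +-mono-≤ (above-antiˡ x s≤t) (exceed-antiʳ u k s≤t)

exceed-flat : ∀ u k s t → s ≤ t → (∀ q → 1 ≤ q → q ≤ k → at u q ≤ s ⊎ t < at u q) → exceed u k s ≡ exceed u k t
exceed-flat u       zero    s t s≤t gap = refl
exceed-flat []      (suc k) s t s≤t gap = refl
exceed-flat (x ∷ u) (suc k) s t s≤t gap =
  cong₂ _+_ head (exceed-flat u k s t s≤t λ { (suc q) _ q≤k → gap (suc (suc q)) (s≤s z≤n) (s≤s q≤k) })
  where
    head : above s x ≡ above t x
    head with gap 1 ≤-refl (s≤s z≤n)
    ... | inj₁ x≤s = trans (above-no x≤s) (sym (above-no (≤-trans x≤s s≤t)))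
    ... | inj₂ t<x = trans (above-yes (≤-<-trans s≤t t<x)) (sym (above-yes t<x))

exceed-strict : ∀ u k q s t → 1 ≤ q → q ≤ k → q ≤ length u → s < at u q → at u q ≤ t → s ≤ t →
                exceed u k t < exceed u k s
exceed-strict []      k       q             s t 1≤q q≤k q≤len with () ← ≤-trans 1≤q q≤len
exceed-strict (x ∷ u) (suc k) (suc zero)    s t 1≤q q≤k q≤len s<x x≤t s≤t =
  subst₂ (λ α β → α + exceed u k t < β + exceed u k s) (sym (above-no x≤t)) (sym (above-yes s<x))
         (s≤s (exceed-antiʳ u k s≤t))
exceed-strict (x ∷ u) (suc k) (suc (suc q)) s t 1≤q (s≤s q≤k) (s≤s q≤len) s<uq uq≤t s≤t =
  +-mono-≤-< (above-antiˡ x s≤t) (exceed-strict u k (suc q) s t (s≤s z≤n) q≤k q≤len s<uq uq≤t s≤t)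

exceed-smallPrefix : ∀ u k i s → i ≤ k → (∀ q → 1 ≤ q → q ≤ i → q ≤ length u → at u q ≤ s) → exceed u k s ≤ k ∸ i
exceed-smallPrefix u       k       zero    s _        _     = exceed≤k u k s
exceed-smallPrefix []      (suc k) (suc i) s _        _     = z≤n
exceed-smallPrefix (x ∷ u) (suc k) (suc i) s (s≤s i≤k) small =
  subst (λ z → z + exceed u k s ≤ k ∸ i) (sym (above-no (small 1 ≤-refl (s≤s z≤n) (s≤s z≤n))))
    (exceed-smallPrefix u k i s i≤k λ { (suc q) _ q≤i q≤len → small (suc (suc q)) (s≤s z≤n) (s≤s q≤i) (s≤s q≤len) })

exceed-extend : ∀ u k c s → k ≤ c → exceed u c s ≤ exceed u k s + (c ∸ k)
exceed-extend u       zero    c       s _        = exceed≤k u c s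
exceed-extend []      (suc k) c       s _        = subst (_≤ exceed [] (suc k) s + (c ∸ suc k)) (sym (exceed-[] c s)) z≤n
exceed-extend (x ∷ u) (suc k) (suc c) s (s≤s k≤c) =
  subst (above s x + exceed u c s ≤_) (sym (+-assoc (above s x) _ _)) (+-monoʳ-≤ (above s x) (exceed-extend u k c s k≤c))

∸-split : ∀ c k i → i ≤ k → k ≤ c → c ∸ i ≡ (c ∸ k) + (k ∸ i)
∸-split c k i i≤k k≤c = sym (trans (sym (+-∸-assoc (c ∸ k) i≤k)) (cong (_∸ i) (m∸n+n≡m k≤c)))

exceed-largeSuffix : ∀ u c i s → 1 ≤ i → i ≤ c → c ≤ length u → (∀ q → i ≤ q → q ≤ c → s < at u q) →
                     suc (c ∸ i) ≤ exceed u c s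
exceed-largeSuffix u       (suc c) (suc zero)    s _ _ c≤len large = ≤-reflexive (sym (allLarge u (suc c) c≤len large))
  where
    allLarge : ∀ u c → c ≤ length u → (∀ q → 1 ≤ q → q ≤ c → s < at u q) → exceed u c s ≡ c
    allLarge u       zero    _        _     = refl
    allLarge (x ∷ u) (suc c) (s≤s c≤) large =
      cong₂ _+_ (above-yes (large 1 ≤-refl (s≤s z≤n)))
                (allLarge u c c≤ λ { (suc q) _ q≤c → large (suc (suc q)) (s≤s z≤n) (s≤s q≤c) })
exceed-largeSuffix (x ∷ u) (suc c) (suc (suc i)) s _ (s≤s i≤c) (s≤s c≤len) large =
  ≤-trans (exceed-largeSuffix u c (suc i) s (s≤s z≤n) i≤c c≤len λ { (suc q) i≤q q≤c → large (suc (suc q)) (s≤s i≤q) (s≤s q≤c) })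
          (m≤n+m (exceed u c s) (above s x))

-- Distinct and increasing lists.

Increasing : List ℕ → Set
Increasing = AllPairs _<_

Increasing⇒Unique : ∀ {xs} → Increasing xs → Unique xs
Increasing⇒Unique = AllPairs.map <⇒≢

Unique-resp-↭ : ∀ {xs ys} → xs ↭ ys → Unique xs → Unique ys
Unique-resp-↭ p = PermSetoid.Unique-resp-↭ (setoid ℕ) (↭⇒↭ₛ p)

remove : ∀ {x ys} → x ∈ ys → Σ (List ℕ) λ ys' → (ys ↭ x ∷ ys') × (∀ {y} → y ∈ ys → y ≢ x → y ∈ ys')
remove {x} x∈ys with ∈-∃++ x∈ys
... | us , vs , refl = us ++ vs , shift x us vs , λ y∈ y≢x → rest (∈-resp-↭ (shift x us vs) y∈) y≢x
  where
    rest : ∀ {y} → y ∈ x ∷ (us ++ vs) → y ≢ x → y ∈ us ++ vs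
    rest (here y≡x) y≢x = ⊥-elim (y≢x y≡x)
    rest (there y∈) _   = y∈

count-⊆ : ∀ f {xs ys} → Unique xs → xs ⊆ ys → count f xs ≤ count f ys
count-⊆ f []                    _  = z≤n
count-⊆ f {x ∷ xs} (x∉xs ∷ uxs) xs⊆ys with remove (xs⊆ys (here refl))
... | ys' , ys↭ , rest =
  subst (f x + count f xs ≤_) (sym (count-↭ f ys↭))
        (+-monoʳ-≤ (f x) (count-⊆ f uxs λ y∈xs → rest (xs⊆ys (there y∈xs)) λ { refl → All.lookup x∉xs y∈xs refl }))

sameMembers⇒↭ : ∀ {xs ys} → Unique xs → Unique ys → xs ⊆ ys → ys ⊆ xs → xs ↭ ys
sameMembers⇒↭ {[]}     {[]}     _ _ _ _ = ↭-refl
sameMembers⇒↭ {[]}     {y ∷ ys} _ _ _ ys⊆xs with () ← ys⊆xs (here refl)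
sameMembers⇒↭ {x ∷ xs} {ys} (x∉xs ∷ uxs) uys xs⊆ys ys⊆xs with remove (xs⊆ys (here refl))
... | ys' , ys↭ , rest with Unique-resp-↭ ys↭ uys
...   | x∉ys' ∷ uys' = ↭-trans (↭-prep x (sameMembers⇒↭ uxs uys' forth back)) (↭-sym ys↭)
  where
    forth : xs ⊆ ys'
    forth y∈xs = rest (xs⊆ys (there y∈xs)) λ { refl → All.lookup x∉xs y∈xs refl }
    back : ys' ⊆ xs
    back y∈ys' with ys⊆xs (∈-resp-↭ (↭-sym ys↭) (there y∈ys'))
    ... | here refl = ⊥-elim (All.lookup x∉ys' y∈ys' refl)
    ... | there y∈xs = y∈xs

take-drop-disjoint : ∀ k (u : List ℕ) {y} → Unique u → y ∈ take k u → y ∈ drop k u → ⊥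
take-drop-disjoint (suc k) (x ∷ u) (x∉u ∷ _) (here refl) y∈drop = All.lookup x∉u (∈-drop k u y∈drop) refl
take-drop-disjoint (suc k) (x ∷ u) (_ ∷ uu)  (there y∈)  y∈drop = take-drop-disjoint k u uu y∈ y∈drop

-- an increasing list D has the least possible counts: a prefix of length m
-- of D counts at most m minus the number of entries of D that are ≤ s
exceed-increasing : ∀ D m s → Increasing D → exceed D m s ≤ m ∸ count (atMost s) D
exceed-increasing []      m       s _ = subst (_≤ m) (sym (exceed-[] m s)) z≤n
exceed-increasing (d ∷ D) zero    s _ = z≤n
exceed-increasing (d ∷ D) (suc m) s (d<D ∷ incD) with ≤-<-connex d s
... | inj₁ d≤s = subst₂ (λ α β → α + exceed D m s ≤ suc m ∸ (β + count (atMost s) D))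
                        (sym (above-no d≤s)) (sym (atMost-yes d≤s)) (exceed-increasing D m s incD)
... | inj₂ s<d = subst₂ (λ α β → α + exceed D m s ≤ suc m ∸ (β + count (atMost s) D))
                        (sym (above-yes s<d)) (sym (atMost-no s<d))
                        (subst (λ z → suc (exceed D m s) ≤ suc m ∸ z) (sym (noneAtMost (All.map (<-trans s<d) d<D)))
                               (s≤s (exceed≤k D m s)))
  where
    noneAtMost : ∀ {xs} → All (s <_) xs → count (atMost s) xs ≡ 0
    noneAtMost []              = refl
    noneAtMost (s<x ∷ s<xs) = cong₂ _+_ (atMost-no s<x) (noneAtMost s<xs)

increasing-least : ∀ D E m s → Increasing D → Unique E → E ⊆ D → m ≤ length E → exceed D m s ≤ exceed E m s
increasing-least D E m s incD uE E⊆D m≤len = begin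
  exceed D m s                                            ≤⟨ exceed-increasing D m s incD ⟩
  m ∸ count (atMost s) D                                  ≤⟨ ∸-monoʳ-≤ m atMost-bound ⟩
  m ∸ count (atMost s) (take m E)                         ≡⟨ cong (_∸ count (atMost s) (take m E)) (sym (exceed+atMost E m s m≤len)) ⟩
  exceed E m s + count (atMost s) (take m E) ∸ count (atMost s) (take m E) ≡⟨ m+n∸n≡m (exceed E m s) (count (atMost s) (take m E)) ⟩
  exceed E m s                                            ∎
  where
    open ≤-Reasoning
    atMost-bound : count (atMost s) (take m E) ≤ count (atMost s) D
    atMost-bound = ≤-trans (count-take≤ (atMost s) m E) (count-⊆ (atMost s) uE E⊆D)

at-applyUpTo : ∀ f m p → 1 ≤ p → p ≤ m → at (applyUpTo f m) p ≡ f (p ∸ 1)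
at-applyUpTo f zero    p             1≤p p≤m with () ← ≤-trans 1≤p p≤m
at-applyUpTo f (suc m) (suc zero)    1≤p p≤m = refl
at-applyUpTo f (suc m) (suc (suc p)) 1≤p (s≤s p≤m) = at-applyUpTo (f ∘ suc) m (suc p) (s≤s z≤n) p≤m

length-range1 : ∀ b → length (range 1 b) ≡ b
length-range1 b = length-applyUpTo (1 +_) b

at-range1 : ∀ b p → 1 ≤ p → p ≤ b → at (range 1 b) p ≡ p
at-range1 b (suc p) 1≤p p≤b = at-applyUpTo (1 +_) b (suc p) 1≤p p≤b

∈-range1⁺ : ∀ b {x} → 1 ≤ x → x ≤ b → x ∈ range 1 b
∈-range1⁺ b {suc x} _ x<b = ∈-applyUpTo⁺ (1 +_) x<b

range-increasing : ∀ a b → Increasing (range a b)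
range-increasing a b = AllPairsₚ.applyUpTo⁺₁ (a +_) (suc b ∸ a) (λ i<j _ → +-monoʳ-< a i<j)

findFirst-spec : ∀ (P : ℕ → Bool) f m {p} → findFirst P (applyUpTo f m) ≡ just p →
                 Σ ℕ λ i → i < m × p ≡ f i × True (P p) × (∀ i' → i' < i → ¬ True (P (f i')))
findFirst-spec P f zero    ()
findFirst-spec P f (suc m) {p} found with P (f 0) in eq
... | true with found
...   | refl = 0 , s≤s z≤n , refl , subst True (sym eq) tt , λ _ ()
findFirst-spec P f (suc m) {p} found | false with findFirst-spec P (f ∘ suc) m found
...   | i , i<m , refl , Pp , earlier = suc i , s≤s i<m , refl , Pp , notEarlier
  where
    notEarlier : ∀ i' → i' < suc i → ¬ True (P (f i'))
    notEarlier zero     _         Pf0 = subst True eq Pf0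
    notEarlier (suc i') (s≤s i'<i) = earlier i' i'<i

findFirst-exists : ∀ (P : ℕ → Bool) f m i → i < m → True (P (f i)) → Σ ℕ λ p → findFirst P (applyUpTo f m) ≡ just p
findFirst-exists P f (suc m) i i<m Pfi with P (f 0) in eq
... | true = f 0 , refl
findFirst-exists P f (suc m) zero    i<m       Pfi | false = ⊥-elim (subst True eq Pfi)
findFirst-exists P f (suc m) (suc i) (s≤s i<m) Pfi | false = findFirst-exists P (f ∘ suc) m i i<m Pfi

findFirst-range-spec : ∀ (P : ℕ → Bool) a b {p} → findFirst P (range a b) ≡ just p →
                       a ≤ p × p ≤ b × True (P p) × (∀ q → a ≤ q → q < p → ¬ True (P q))
findFirst-range-spec P a b found with findFirst-spec P (a +_) (suc b ∸ a) found
... | i , i<len , refl , Pp , earlier = m≤m+n a i , p≤b , Pp , notEarlier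
  where
    a≤b+1 : a ≤ suc b
    a≤b+1 = <⇒≤ (m∸n≢0⇒n<m (λ len≡0 → <⇒≱ i<len (subst (_≤ i) (sym len≡0) z≤n)))
    p≤b : a + i ≤ b
    p≤b = ≤-pred (subst (a + i <_) (m+[n∸m]≡n a≤b+1) (+-monoʳ-< a i<len))
    notEarlier : ∀ q → a ≤ q → q < a + i → ¬ True (P q)
    notEarlier q a≤q q<p = subst (¬_ ∘ True ∘ P) (m+[n∸m]≡n a≤q)
      (earlier (q ∸ a) (+-cancelˡ-< a (q ∸ a) i (subst (_< a + i) (sym (m+[n∸m]≡n a≤q)) q<p)))

findFirst-range-exists : ∀ (P : ℕ → Bool) a b q → a ≤ q → q ≤ b → True (P q) → Σ ℕ λ p → findFirst P (range a b) ≡ just p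
findFirst-range-exists P a b q a≤q q≤b Pq =
  findFirst-exists P (a +_) (suc b ∸ a) (q ∸ a) (∸-monoˡ-< (s≤s q≤b) a≤q) (subst (True ∘ P) (sym (m+[n∸m]≡n a≤q)) Pq)

window⁻ : ∀ {x y t} → True ((x <ᵇ y) ∧ (y ≤ᵇ t)) → x < y × y ≤ t
window⁻ {x} {y} {t} w = <ᵇ⇒< x y (proj₁ (Equivalence.to T-∧ w)) , ≤ᵇ⇒≤ y t (proj₂ (Equivalence.to T-∧ w))

window⁺ : ∀ {x y t} → x < y → y ≤ t → True ((x <ᵇ y) ∧ (y ≤ᵇ t))
window⁺ x<y y≤t = Equivalence.from T-∧ (<⇒<ᵇ x<y , ≤⇒≤ᵇ y≤t)

-- Filtering by a downward closed predicate keeps an initial segment; this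
-- describes the column lengths of a Young diagram.

module DownClosedFilter (Q : ℕ → Bool) where

  DownClosed : (ℕ → ℕ) → ℕ → Set
  DownClosed f m = ∀ i i' → i ≤ i' → i' < m → True (Q (f i')) → True (Q (f i))

  filter-length≤ : ∀ f m → length (filterᵇ Q (applyUpTo f m)) ≤ m
  filter-length≤ f m = ≤-trans (length-filter (T? ∘ Q) (applyUpTo f m)) (≤-reflexive (length-applyUpTo f m))

  filter-initial : ∀ f m → DownClosed f m →
    let L = length (filterᵇ Q (applyUpTo f m)) in
    (∀ i → i < m → True (Q (f i)) → i < L) × (∀ i → i < L → True (Q (f i)))
  filter-initial f zero    closed = (λ { _ () _ }) , (λ _ ())
  filter-initial f (suc m) closed with Q (f 0) in eq
  ... | true = inside , kept
    where
      rest = filter-initial (f ∘ suc) m λ i i' i≤i' i'<m → closed (suc i) (suc i') (s≤s i≤i') (s≤s i'<m)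
      inside : ∀ i → i < suc m → True (Q (f i)) → i < suc (length (filterᵇ Q (applyUpTo (f ∘ suc) m)))
      inside zero    _          _   = s≤s z≤n
      inside (suc i) (s≤s i<m) Qfi = s≤s (proj₁ rest i i<m Qfi)
      kept : ∀ i → i < suc (length (filterᵇ Q (applyUpTo (f ∘ suc) m))) → True (Q (f i))
      kept zero    _         = subst True (sym eq) tt
      kept (suc i) (s≤s i<L) = proj₂ rest i i<L
  ... | false = inside , kept
    where
      rest = filter-initial (f ∘ suc) m λ i i' i≤i' i'<m → closed (suc i) (suc i') (s≤s i≤i') (s≤s i'<m)
      head-fails : ∀ i → i < suc m → ¬ True (Q (f i))
      head-fails i i<m Qfi = subst True eq (closed 0 i z≤n i<m Qfi)
      inside : ∀ i → i < suc m → True (Q (f i)) → i < length (filterᵇ Q (applyUpTo (f ∘ suc) m))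
      inside i i<m Qfi = ⊥-elim (head-fails i i<m Qfi)
      kept : ∀ i → i < length (filterᵇ Q (applyUpTo (f ∘ suc) m)) → True (Q (f i))
      kept i i<L = ⊥-elim (head-fails (suc i) (s≤s (<-≤-trans i<L (filter-length≤ (f ∘ suc) m))) (proj₂ rest i i<L))

module Shape (n : ℕ) (lam : ℕ → ℕ) (isP : IsPartition n lam) where

  lam-antitone : ∀ i i' → 1 ≤ i → i ≤ i' → i' ≤ n → lam i' ≤ lam i
  lam-antitone i i'       1≤i i≤i' i'≤n with m≤n⇒m<n∨m≡n i≤i'
  lam-antitone i i'       1≤i i≤i' i'≤n | inj₂ refl = ≤-refl
  lam-antitone i (suc i') 1≤i i≤i' i'≤n | inj₁ (s≤s i≤i'') =
    ≤-trans (isP i' (≤-trans 1≤i i≤i'') i'≤n) (lam-antitone i i' 1≤i i≤i'' (≤-trans (n≤1+n i') i'≤n))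

  c : ℕ → ℕ
  c j = colLen n lam j

  private
    module F (j : ℕ) = DownClosedFilter (λ i → j ≤ᵇ lam i)

    closed : ∀ j → F.DownClosed j (1 +_) n
    closed j i i' i≤i' i'<n j≤lam = ≤⇒≤ᵇ (≤-trans (≤ᵇ⇒≤ j (lam (suc i')) j≤lam)
                                                  (lam-antitone (suc i) (suc i') (s≤s z≤n) (s≤s i≤i') i'<n))

  row≤colLen : ∀ j i → 1 ≤ i → i ≤ n → j ≤ lam i → i ≤ c j
  row≤colLen j (suc i) _ i<n j≤lam = proj₁ (F.filter-initial j (1 +_) n (closed j)) i i<n (≤⇒≤ᵇ j≤lam)

  colLen⇒inRow : ∀ j i → 1 ≤ i → i ≤ c j → j ≤ lam i
  colLen⇒inRow j (suc i) _ i<c = ≤ᵇ⇒≤ j (lam (suc i)) (proj₂ (F.filter-initial j (1 +_) n (closed j)) i i<c)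

  c≤n : ∀ j → c j ≤ n
  c≤n j = F.filter-length≤ j (1 +_) n

  inShape : ∀ j i → 1 ≤ j → 1 ≤ i → i ≤ c j → InShape n lam j i
  inShape j i 1≤j 1≤i i≤c = 1≤i , ≤-trans i≤c (c≤n j) , 1≤j , colLen⇒inRow j i 1≤i i≤c

  c-antitone : ∀ j → c (suc j) ≤ c j
  c-antitone j with c (suc j) in eq
  ... | zero  = z≤n
  ... | suc k = row≤colLen j (suc k) (s≤s z≤n) (≤-trans (≤-reflexive (sym eq)) (c≤n (suc j)))
                  (≤-trans (n≤1+n j) (colLen⇒inRow (suc j) (suc k) (s≤s z≤n) (≤-reflexive (sym eq))))

-- Rotating values along a chain of positions.

lastOf : ℕ → List ℕ → ℕ
lastOf x []       = x
lastOf x (y ∷ ys) = lastOf y ys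

initOf : ℕ → List ℕ → List ℕ
initOf x []       = []
initOf x (y ∷ ys) = x ∷ initOf y ys

reverse-lastOf : ∀ x xs → reverse (x ∷ xs) ≡ lastOf x xs ∷ reverse (initOf x xs)
reverse-lastOf x []       = refl
reverse-lastOf x (y ∷ ys) = begin
  reverse (x ∷ y ∷ ys)                                    ≡⟨ unfold-reverse x (y ∷ ys) ⟩
  reverse (y ∷ ys) ∷ʳ x                          ≡⟨ cong (_∷ʳ x) (reverse-lastOf y ys) ⟩
  lastOf y ys ∷ reverse (initOf y ys) ∷ʳ x       ≡⟨ cong (lastOf y ys ∷_) (sym (unfold-reverse x (initOf y ys))) ⟩
  lastOf y ys ∷ reverse (x ∷ initOf y ys)                 ∎
  where open ≡-Reasoning

rotR-cons : ∀ x xs → rotR (x ∷ xs) ≡ lastOf x xs ∷ initOf x xs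
rotR-cons x xs = trans (unfold (reverse-lastOf x xs)) (cong (lastOf x xs ∷_) (reverse-involutive _))
  where
    unfold : ∀ {y ys} → reverse (x ∷ xs) ≡ y ∷ ys → rotR (x ∷ xs) ≡ y ∷ reverse ys
    unfold eq with reverse (x ∷ xs) | eq
    ... | _ | refl = refl

setMany-setAt : ∀ σ q x ps vs → All (q ≢_) ps → setMany (setAt σ q x) ps vs ≡ setAt (setMany σ ps vs) q x
setMany-setAt σ q x []       vs       _            = refl
setMany-setAt σ q x (p ∷ ps) []       _            = refl
setMany-setAt σ q x (p ∷ ps) (v ∷ vs) (q≢p ∷ q≢ps) =
  trans (cong (λ z → setMany z ps vs) (setAt-comm σ q p x v q≢p)) (setMany-setAt (setAt σ p v) q x ps vs q≢ps)

All<⇒All≢ : ∀ {a xs} → All (a <_) xs → All (a ≢_) xs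
All<⇒All≢ = All.map <⇒≢

module Rotation (n : ℕ) (π : List ℕ) (t : ℕ) (lenπ : length π ≡ n) where

  V : ℕ → ℕ
  V = at π

  NoEarlierInWindow : ℕ → ℕ → Set
  NoEarlierInWindow a p = ∀ q → 1 ≤ q → q < p → V a < V q → V q ≤ t → ⊥

  data Chain (a : ℕ) : List ℕ → Set where
    arrived : V a ≡ t → Chain a []
    next    : ∀ {p ps} → a < p → p ≤ n → V a < V p → NoEarlierInWindow a p → Chain p ps → Chain a (p ∷ ps)

  chain-last : ∀ {a ps} → Chain a ps → lastOf (V a) (map V ps) ≡ t
  chain-last (arrived Va≡t)         = Va≡t
  chain-last (next _ _ _ _ chain)   = chain-last chain

  chain-≤t : ∀ {a ps} → Chain a ps → V a ≤ t
  chain-≤t (arrived Va≡t)          = ≤-reflexive Va≡t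
  chain-≤t (next _ _ Va<Vp _ chain) = ≤-trans (<⇒≤ Va<Vp) (chain-≤t chain)

  chain-increasing : ∀ {a ps} → Chain a ps → All (a <_) ps
  chain-increasing (arrived _)             = []
  chain-increasing (next a<p _ _ _ chain) = a<p ∷ All.map (<-trans a<p) (chain-increasing chain)

  -- the rotation performed by the greedy procedure ...
  rotateAlong : ℕ → List ℕ → List ℕ
  rotateAlong a ps = setMany (setAt π a (lastOf (V a) (map V ps))) ps (initOf (V a) (map V ps))

  -- ... as a product of transpositions (a p₁)(p₁ p₂)…
  swapsAlong : ℕ → List ℕ → List ℕ
  swapsAlong a []       = π
  swapsAlong a (p ∷ ps) = swapAt (swapsAlong p ps) a p

  length-swapsAlong : ∀ a ps → length (swapsAlong a ps) ≡ n
  length-swapsAlong a []       = lenπ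
  length-swapsAlong a (p ∷ ps) = trans (length-swapAt (swapsAlong p ps) a p) (length-swapsAlong p ps)

  swapsAlong-untouched : ∀ a ps q → q ≢ a → All (q ≢_) ps → at (swapsAlong a ps) q ≡ V q
  swapsAlong-untouched a []       q _   _            = refl
  swapsAlong-untouched a (p ∷ ps) q q≢a (q≢p ∷ q≢ps) =
    trans (at-setAt-≢ (setAt (swapsAlong p ps) a _) p q _ (q≢p ∘ sym))
      (trans (at-setAt-≢ (swapsAlong p ps) a q _ (q≢a ∘ sym)) (swapsAlong-untouched p ps q q≢p q≢ps))

  swapsAlong-start : ∀ {a ps} → 1 ≤ a → a ≤ n → Chain a ps → at (swapsAlong a ps) a ≡ t
  swapsAlong-start         1≤a a≤n (arrived Va≡t) = Va≡t
  swapsAlong-start {a} {p ∷ ps} 1≤a a≤n (next a<p p≤n _ _ chain) =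
    trans (at-setAt-≢ (setAt R a (at R p)) p a (at R a) (<⇒≢ a<p ∘ sym))
      (trans (at-setAt-≡ R a (at R p) 1≤a (subst (a ≤_) (sym (length-swapsAlong p ps)) a≤n))
             (swapsAlong-start (≤-trans 1≤a (<⇒≤ a<p)) p≤n chain))
    where R = swapsAlong p ps

  rotateAlong≡swapsAlong : ∀ {a ps} → 1 ≤ a → a ≤ n → Chain a ps → rotateAlong a ps ≡ swapsAlong a ps
  rotateAlong≡swapsAlong {a} {[]}     _   _   _ = setAt-at π a
  rotateAlong≡swapsAlong {a} {p ∷ ps} 1≤a a≤n (next a<p p≤n _ _ chain) = begin
    setMany (setAt (setAt π a last) p (V a)) ps init   ≡⟨ cong (λ z → setMany z ps init) (setAt-comm π a p last (V a) a≢p) ⟩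
    setMany (setAt (setAt π p (V a)) a last) ps init   ≡⟨ setMany-setAt _ a last ps init a∉ps ⟩
    setAt (setMany (setAt π p (V a)) ps init) a last   ≡⟨ cong (λ z → setAt (setMany z ps init) a last) (sym (setAt-idem π p last (V a))) ⟩
    setAt (setMany (setAt (setAt π p last) p (V a)) ps init) a last
                                                       ≡⟨ cong (λ z → setAt z a last) (setMany-setAt _ p (V a) ps init p∉ps) ⟩
    setAt (setAt (rotateAlong p ps) p (V a)) a last     ≡⟨ cong (λ z → setAt (setAt z p (V a)) a last) rotate-rest ⟩
    setAt (setAt R p (V a)) a last                      ≡⟨ sym (setAt-comm R a p last (V a) a≢p) ⟩
    setAt (setAt R a last) p (V a)                      ≡⟨ cong₂ (λ x y → setAt (setAt R a x) p y) (sym R-at-p) (sym R-at-a) ⟩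
    swapAt R a p                                        ∎
    where
      open ≡-Reasoning
      last = lastOf (V p) (map V ps)
      init = initOf (V p) (map V ps)
      R = swapsAlong p ps
      a≢p = <⇒≢ a<p
      p∉ps = All<⇒All≢ (chain-increasing chain)
      a∉ps = All<⇒All≢ (All.map (<-trans a<p) (chain-increasing chain))
      rotate-rest : rotateAlong p ps ≡ R
      rotate-rest = rotateAlong≡swapsAlong (≤-trans 1≤a (<⇒≤ a<p)) p≤n chain
      R-at-p : at R p ≡ last
      R-at-p = trans (swapsAlong-start (≤-trans 1≤a (<⇒≤ a<p)) p≤n chain) (sym (chain-last chain))
      R-at-a : at R a ≡ V a
      R-at-a = swapsAlong-untouched p ps a a≢p a∉ps

  -- each transposition (a p) moves the larger value V p ≤ t forward: a Bruhat step
  swapsAlong-bruhat : ∀ {a ps} → 1 ≤ a → a ≤ n → Chain a ps → π ≤B swapsAlong a ps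
  swapsAlong-bruhat 1≤a a≤n (arrived _) = ε
  swapsAlong-bruhat {a} {p ∷ ps} 1≤a a≤n (next a<p p≤n Va<Vp _ chain) =
    swapsAlong-bruhat 1≤p p≤n chain ◅◅
      (step a p 1≤a a<p (subst (p ≤_) (sym (length-swapsAlong p ps)) p≤n)
         (subst₂ _<_ (sym (swapsAlong-untouched p ps a (<⇒≢ a<p) (All<⇒All≢ (All.map (<-trans a<p) (chain-increasing chain)))))
                     (sym (swapsAlong-start 1≤p p≤n chain))
                     (<-≤-trans Va<Vp (chain-≤t chain))) ◅ ε)
    where 1≤p = ≤-trans 1≤a (<⇒≤ a<p)

  swapsAlong-↭ : ∀ {a ps} → 1 ≤ a → a ≤ n → Chain a ps → swapsAlong a ps ↭ π
  swapsAlong-↭ 1≤a a≤n (arrived _) = ↭-refl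
  swapsAlong-↭ {a} {p ∷ ps} 1≤a a≤n (next a<p p≤n _ _ chain) =
    ↭-trans (swapAt-↭ (swapsAlong p ps) a p 1≤a a<p (subst (p ≤_) (sym (length-swapsAlong p ps)) p≤n))
            (swapsAlong-↭ (≤-trans 1≤a (<⇒≤ a<p)) p≤n chain)

  -- The rotation stays below any X with π ≼ X, provided that X strictly
  -- dominates π wherever a single transposition (a p) of the chain could
  -- raise a count: on prefixes a ≤ k < p and thresholds V a ≤ s < t.
  StrictlyBelowOn : List ℕ → ℕ → ℕ → Set
  StrictlyBelowOn X a p = ∀ k s → a ≤ k → k < p → V a ≤ s → s < t → exceed π k s < exceed X k s

  StrictlyBelowAlong : List ℕ → ℕ → List ℕ → Set
  StrictlyBelowAlong X a []       = ⊤
  StrictlyBelowAlong X a (p ∷ ps) = StrictlyBelowOn X a p × StrictlyBelowAlong X p ps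

  swapsAlong-below : ∀ X → π ≼ X → ∀ {a ps} → 1 ≤ a → a ≤ n → Chain a ps → StrictlyBelowAlong X a ps →
                     swapsAlong a ps ≼ X
  swapsAlong-below X π≼X 1≤a a≤n (arrived _) _ = π≼X
  swapsAlong-below X π≼X {a} {p ∷ ps} 1≤a a≤n (next a<p p≤n Va<Vp _ chain) (strictHere , strictRest) k s =
    SwapCount.swap-stays-below R a p k s 1≤a a<p (subst (p ≤_) (sym (length-swapsAlong p ps)) p≤n) X
      (swapsAlong-below X π≼X 1≤p p≤n chain strictRest k s) strict
      (subst₂ _<_ (sym R-at-a) (sym R-at-p) (<-≤-trans Va<Vp (chain-≤t chain)))
    where
      R = swapsAlong p ps
      1≤p = ≤-trans 1≤a (<⇒≤ a<p)
      R-at-a : at R a ≡ V a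
      R-at-a = swapsAlong-untouched p ps a (<⇒≢ a<p) (All<⇒All≢ (All.map (<-trans a<p) (chain-increasing chain)))
      R-at-p : at R p ≡ t
      R-at-p = swapsAlong-start 1≤p p≤n chain

      -- below position p the swaps of the rest of the chain have not acted yet
      R-agrees : ∀ k → k < p → exceed R k s ≡ exceed π k s
      R-agrees k k<p = exceed-agree R π k s
        (λ q _ q≤k → swapsAlong-untouched p ps q (<⇒≢ (≤-<-trans q≤k k<p))
                       (All<⇒All≢ (All.map (<-trans (≤-<-trans q≤k k<p)) (chain-increasing chain))))
        (trans (length-swapsAlong p ps) (sym lenπ))
      strict : a ≤ k → k < p → at R a ≤ s → s < at R p → exceed R k s < exceed X k s
      strict a≤k k<p Ra≤s s<Rp = subst (_< exceed X k s) (sym (R-agrees k k<p))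
                                   (strictHere k s a≤k k<p (subst (_≤ s) R-at-a Ra≤s) (subst (s <_) R-at-p s<Rp))

>>=-just : ∀ {A B : Set} {m : Maybe A} {x : A} (k : A → Maybe B) → m ≡ just x → (m >>= k) ≡ k x
>>=-just k refl = refl

if-true : ∀ {A : Set} {b : Bool} {x y : A} → b ≡ true → (if b then x else y) ≡ x
if-true refl = refl

if-false : ∀ {A : Set} {b : Bool} {x y : A} → b ≡ false → (if b then x else y) ≡ y
if-false refl = refl

module Chase (n : ℕ) (π : List ℕ) (t : ℕ) (lenπ : length π ≡ n) where
  open Rotation n π t lenπ

  chase-succeeds : ∀ fuel cur → 1 ≤ cur → cur ≤ n → V cur ≤ t → t ∸ V cur < fuel → NoEarlierInWindow cur cur →
                   ∀ qt → 1 ≤ qt → qt ≤ n → V qt ≡ t →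
                   Σ (List ℕ) λ rest → chase n fuel π t cur ≡ just rest × Chain cur rest
  chase-succeeds (suc fuel) cur 1≤cur cur≤n Vcur≤t gap noneBefore qt 1≤qt qt≤n Vqt≡t with at π cur ≡ᵇ t in eq
  ... | true  = [] , refl , arrived (≡ᵇ⇒≡ (V cur) t (subst True (sym eq) tt))
  ... | false = p ∷ rest , result , next cur<p p≤n Vcur<Vp noEarlier chain
    where
      P : ℕ → Bool
      P q = (V cur <ᵇ V q) ∧ (V q ≤ᵇ t)
      Vcur<t : V cur < t
      Vcur<t = ≤∧≢⇒< Vcur≤t (λ Vcur≡t → subst True eq (≡⇒≡ᵇ (V cur) t Vcur≡t))
      first = findFirst-range-exists P 1 n qt 1≤qt qt≤n (window⁺ (subst (V cur <_) (sym Vqt≡t) Vcur<t) (≤-reflexive Vqt≡t))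
      p = proj₁ first
      found : findFirst P (range 1 n) ≡ just p
      found = proj₂ first
      spec = findFirst-range-spec P 1 n found
      1≤p = proj₁ spec
      p≤n = proj₁ (proj₂ spec)
      Vcur<Vp : V cur < V p
      Vcur<Vp = proj₁ (window⁻ (proj₁ (proj₂ (proj₂ spec))))
      Vp≤t : V p ≤ t
      Vp≤t = proj₂ (window⁻ (proj₁ (proj₂ (proj₂ spec))))
      noEarlier : NoEarlierInWindow cur p
      noEarlier q 1≤q q<p Vcur<Vq Vq≤t = proj₂ (proj₂ (proj₂ spec)) q 1≤q q<p (window⁺ Vcur<Vq Vq≤t)
      cur<p : cur < p
      cur<p with ≤-<-connex p cur
      ... | inj₂ cur<p = cur<p
      ... | inj₁ p≤cur with m≤n⇒m<n∨m≡n p≤cur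
      ...   | inj₁ p<cur = ⊥-elim (noneBefore p 1≤p p<cur Vcur<Vp Vp≤t)
      ...   | inj₂ p≡cur = ⊥-elim (<-irrefl (cong V (sym p≡cur)) Vcur<Vp)
      recursion = chase-succeeds fuel p 1≤p p≤n Vp≤t
                    (<-≤-trans (∸-monoʳ-< Vcur<Vp Vp≤t) (≤-pred gap))
                    (λ q 1≤q q<p Vp<Vq Vq≤t → noEarlier q 1≤q q<p (<-trans Vcur<Vp Vp<Vq) Vq≤t)
                    qt 1≤qt qt≤n Vqt≡t
      rest = proj₁ recursion
      chain = proj₂ (proj₂ recursion)
      result : (findFirst P (range 1 n) >>= λ p → chase n fuel π t p >>= λ rest → just (p ∷ rest)) ≡ just (p ∷ rest)
      result = trans (>>=-just _ found) (>>=-just (λ rest → just (p ∷ rest)) (proj₁ (proj₂ recursion)))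

perm-length : ∀ n {u} → u ↭ range 1 n → length u ≡ n
perm-length n u↭ = trans (↭-length u↭) (length-range1 n)

perm-unique : ∀ n {u} → u ↭ range 1 n → Unique u
perm-unique n u↭ = Unique-resp-↭ (↭-sym u↭) (Increasing⇒Unique (range-increasing 1 n))

-- Columns of a semistandard tableau.

module Tableau (n : ℕ) (lam : ℕ → ℕ) (isP : IsPartition n lam) (T : ℕ → ℕ → ℕ) (ssyt : IsSSYT n lam T) where
  open Shape n lam isP public

  entry-bounds : ∀ j i → 1 ≤ j → 1 ≤ i → i ≤ c j → 1 ≤ T j i × T j i ≤ n
  entry-bounds j i 1≤j 1≤i i≤c = proj₁ ssyt j i (inShape j i 1≤j 1≤i i≤c)

  row-weak : ∀ j i → 1 ≤ j → 1 ≤ i → i ≤ c (suc j) → T j i ≤ T (suc j) i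
  row-weak j i 1≤j 1≤i i≤c = proj₁ (proj₂ ssyt) j i (inShape j i 1≤j 1≤i (≤-trans i≤c (c-antitone j)))
                                                 (inShape (suc j) i (s≤s z≤n) 1≤i i≤c)

  column-strict : ∀ j p q → 1 ≤ j → 1 ≤ p → p < q → q ≤ c j → T j p < T j q
  column-strict j p (suc q) 1≤j 1≤p (s≤s p≤q) q<c with m≤n⇒m<n∨m≡n p≤q
  ... | inj₂ refl = proj₂ (proj₂ ssyt) j p (inShape j p 1≤j 1≤p (≤-trans (n≤1+n p) q<c)) (inShape j (suc p) 1≤j (s≤s z≤n) q<c)
  ... | inj₁ p<q  = <-trans (column-strict j p q 1≤j 1≤p p<q (≤-trans (n≤1+n q) q<c))
                      (proj₂ (proj₂ ssyt) j q (inShape j q 1≤j (≤-trans 1≤p (<⇒≤ p<q)) (≤-trans (n≤1+n q) q<c))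
                                               (inShape j (suc q) 1≤j (s≤s z≤n) q<c))

  column-weak : ∀ j p q → 1 ≤ j → 1 ≤ p → p ≤ q → q ≤ c j → T j p ≤ T j q
  column-weak j p q 1≤j 1≤p p≤q q≤c with m≤n⇒m<n∨m≡n p≤q
  ... | inj₂ refl = ≤-refl
  ... | inj₁ p<q  = <⇒≤ (column-strict j p q 1≤j 1≤p p<q q≤c)

  col : ℕ → List ℕ
  col j = column n lam T j

  length-col : ∀ j → length (col j) ≡ c j
  length-col j = trans (length-map (T j) (range 1 (c j))) (length-range1 (c j))

  at-col : ∀ j p → 1 ≤ p → p ≤ c j → at (col j) p ≡ T j p
  at-col j p 1≤p p≤c = trans (at-map (T j) (range 1 (c j)) p 1≤p (subst (p ≤_) (sym (length-range1 (c j))) p≤c))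
                             (cong (T j) (at-range1 (c j) p 1≤p p≤c))

  col-increasing : ∀ j → 1 ≤ j → Increasing (col j)
  col-increasing j 1≤j = subst Increasing (sym (map-applyUpTo (1 +_) (T j) (c j)))
    (AllPairsₚ.applyUpTo⁺₁ (T j ∘ (1 +_)) (c j) λ {i} {i'} i<i' i'<c → column-strict j (suc i) (suc i') 1≤j (s≤s z≤n) (s≤s i<i') i'<c)

  Fits : ℕ → List ℕ → Set
  Fits j X = (X ↭ range 1 n) × SameSet (takeᴰ (c j) X) (col j)

  fits-take : ∀ j X → 1 ≤ j → Fits j X → take (c j) X ↭ col j
  fits-take j X 1≤j (X↭ , same) = sameMembers⇒↭ (AllPairsₚ.take⁺ (c j) (perm-unique n X↭)) (Increasing⇒Unique (col-increasing j 1≤j))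
    (λ y∈ → proj₁ (same _) (subst (_ ∈_) (sym (takeᴰ≡take (c j) X)) y∈))
    (λ y∈ → subst (_ ∈_) (takeᴰ≡take (c j) X) (proj₂ (same _) y∈))

  fits-count : ∀ j X → 1 ≤ j → Fits j X → ∀ s → exceed X (c j) s ≡ exceed (col j) (c j) s
  fits-count j X 1≤j fits s = trans (count-↭ (above s) (fits-take j X 1≤j fits))
                                    (sym (exceed-full (col j) (c j) s (≤-reflexive (length-col j))))

  fits-position : ∀ j X → 1 ≤ j → Fits j X → ∀ i → 1 ≤ i → i ≤ c j →
                  Σ ℕ λ q → 1 ≤ q × q ≤ c j × at X q ≡ T j i
  fits-position j X 1≤j fits i 1≤i i≤c
    with ∈⇒at (take (c j) X) (∈-resp-↭ (↭-sym (fits-take j X 1≤j fits))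
           (subst (_∈ col j) (at-col j i 1≤i i≤c) (at-∈ (col j) i 1≤i (subst (i ≤_) (sym (length-col j)) i≤c))))
  ... | q , 1≤q , q≤len , Xq = q , 1≤q , q≤c , trans (sym (at-take (c j) X q q≤c)) Xq
    where q≤c = ≤-trans q≤len (length-take≤ (c j) X)

  ShowsColumn : ℕ → List ℕ → Set
  ShowsColumn j π = (π ↭ range 1 n) × (∀ p → 1 ≤ p → p ≤ c j → at π p ≡ T j p)

  showsColumn-take : ∀ j π → ShowsColumn j π → take (c j) π ≡ col j
  showsColumn-take j π (π↭ , shows) = list-ext (take (c j) π) (col j)
    (trans (length-take≡ (c j) π (subst (c j ≤_) (sym (perm-length n π↭)) (c≤n j))) (sym (length-col j)))
    (λ p 1≤p p≤len → let p≤c = ≤-trans p≤len (length-take≤ (c j) π) in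
       trans (at-take (c j) π p p≤c) (trans (shows p 1≤p p≤c) (sym (at-col j p 1≤p p≤c))))

  showsColumn⇒fits : ∀ j π → ShowsColumn j π → Fits j π
  showsColumn⇒fits j π shows = proj₁ shows , λ x → (λ x∈ → subst (x ∈_) same (subst (x ∈_) (takeᴰ≡take (c j) π) x∈)) ,
                                                     (λ x∈ → subst (x ∈_) (sym (takeᴰ≡take (c j) π)) (subst (x ∈_) (sym same) x∈))
    where same = showsColumn-take j π shows

  -- Filling column j = jp + 1 from the bottom row up.

  module GreedyColumn (jp : ℕ) (1≤jp : 1 ≤ jp) where
    j = suc jp
    cj = c j

    Invariant : ℕ → List ℕ → Set
    Invariant i π = (π ↭ range 1 n)
                  × (∀ p → 1 ≤ p → p ≤ i → at π p ≡ T jp p)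
                  × (∀ p → i < p → p ≤ cj → at π p ≡ T j p)

    Progress : ℕ → List ℕ → List ℕ → Set
    Progress i π π' = Invariant i π' × π ≤B π' × (∀ X → Fits j X → π ≼ X → π' ≼ X)

    unchanged-step : ∀ i' → suc i' ≤ cj → ∀ π → Invariant (suc i') π → T jp (suc i') ≡ T j (suc i') → Invariant i' π
    unchanged-step i' _ π (π↭ , upper , lower) same = π↭ , (λ p 1≤p p≤i' → upper p 1≤p (≤-trans p≤i' (n≤1+n i'))) , lower'
      where
        lower' : ∀ p → i' < p → p ≤ cj → at π p ≡ T j p
        lower' p i'<p p≤c with m≤n⇒m<n∨m≡n i'<p
        ... | inj₂ refl = trans (upper (suc i') (s≤s z≤n) ≤-refl) same
        ... | inj₁ i<p  = lower p i<p p≤c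

    module MoveStep (i' : ℕ) (i≤c : suc i' ≤ cj) (π : List ℕ) (inv : Invariant (suc i') π)
                    (changed : (T jp (suc i') ≡ᵇ T j (suc i')) ≡ false) where
      i = suc i'
      t = T j i
      π↭ = proj₁ inv
      upper = proj₁ (proj₂ inv)
      lower = proj₂ (proj₂ inv)
      lenπ = perm-length n π↭
      open Rotation n π t lenπ

      i≤n : i ≤ n
      i≤n = ≤-trans i≤c (c≤n j)

      t-bounds : 1 ≤ t × t ≤ n
      t-bounds = entry-bounds j i (s≤s z≤n) (s≤s z≤n) i≤c

      Vi<t : V i < t
      Vi<t = subst (_< t) (sym (upper i (s≤s z≤n) ≤-refl))
               (≤∧≢⇒< (row-weak jp i 1≤jp (s≤s z≤n) i≤c) (λ eq → subst True changed (≡⇒≡ᵇ _ _ eq)))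

      upper-small : ∀ q → 1 ≤ q → q ≤ i → V q ≤ V i
      upper-small q 1≤q q≤i = subst₂ _≤_ (sym (upper q 1≤q q≤i)) (sym (upper i (s≤s z≤n) ≤-refl))
                                (column-weak jp q i 1≤jp 1≤q q≤i (≤-trans i≤c (c-antitone jp)))

      lower-large : ∀ q → i < q → q ≤ cj → t < V q
      lower-large q i<q q≤c = subst (t <_) (sym (lower q i<q q≤c)) (column-strict j i q (s≤s z≤n) (s≤s z≤n) i<q q≤c)

      column-outside-window : ∀ q → 1 ≤ q → q ≤ cj → V i < V q → V q ≤ t → ⊥
      column-outside-window q 1≤q q≤c Vi<Vq Vq≤t with ≤-<-connex q i
      ... | inj₁ q≤i = <⇒≱ Vi<Vq (upper-small q 1≤q q≤i)
      ... | inj₂ i<q = <⇒≱ (lower-large q i<q q≤c) Vq≤t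

      target = ∈⇒at π (∈-resp-↭ (↭-sym π↭) (∈-range1⁺ n (proj₁ t-bounds) (proj₂ t-bounds)))
      qt = proj₁ target
      1≤qt : 1 ≤ qt
      1≤qt = proj₁ (proj₂ target)
      qt≤n : qt ≤ n
      qt≤n = subst (qt ≤_) lenπ (proj₁ (proj₂ (proj₂ target)))
      Vqt≡t : V qt ≡ t
      Vqt≡t = proj₂ (proj₂ (proj₂ target))
      cj<qt : cj < qt
      cj<qt with ≤-<-connex qt cj
      ... | inj₂ cj<qt = cj<qt
      ... | inj₁ qt≤c  = ⊥-elim (column-outside-window qt 1≤qt qt≤c (subst (V i <_) (sym Vqt≡t) Vi<t) (≤-reflexive Vqt≡t))

      chain-found : Σ (List ℕ) λ ps → greedyStep n lam T j i π ≡ just (swapsAlong i ps) × Chain i ps × All (cj <_) ps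
      chain-found = i₁ ∷ rest , result , chain , cj<i₁ ∷ All.map (<-trans cj<i₁) (chain-increasing chain₁)
        where
          P : ℕ → Bool
          P q = (V i <ᵇ V q) ∧ (V q ≤ᵇ t)
          first = findFirst-range-exists P (suc cj) n qt cj<qt qt≤n (window⁺ (subst (V i <_) (sym Vqt≡t) Vi<t) (≤-reflexive Vqt≡t))
          i₁ : ℕ
          i₁ = proj₁ first
          found : findFirst P (range (suc cj) n) ≡ just i₁
          found = proj₂ first
          spec = findFirst-range-spec P (suc cj) n found
          cj<i₁ : cj < i₁
          cj<i₁ = proj₁ spec
          i₁≤n : i₁ ≤ n
          i₁≤n = proj₁ (proj₂ spec)
          Vi<Vi₁ : V i < V i₁
          Vi<Vi₁ = proj₁ (window⁻ (proj₁ (proj₂ (proj₂ spec))))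
          Vi₁≤t : V i₁ ≤ t
          Vi₁≤t = proj₂ (window⁻ (proj₁ (proj₂ (proj₂ spec))))

          -- positions before i₁ are either in the column or were rejected by the search
          noEarlier₁ : NoEarlierInWindow i i₁
          noEarlier₁ q 1≤q q<i₁ Vi<Vq Vq≤t with ≤-<-connex q cj
          ... | inj₁ q≤c  = column-outside-window q 1≤q q≤c Vi<Vq Vq≤t
          ... | inj₂ cj<q = proj₂ (proj₂ (proj₂ spec)) q cj<q q<i₁ (window⁺ Vi<Vq Vq≤t)
          chased : Σ (List ℕ) λ rest → chase n n π t i₁ ≡ just rest × Chain i₁ rest
          chased = Chase.chase-succeeds n π t lenπ n i₁ (≤-trans (s≤s z≤n) cj<i₁) i₁≤n Vi₁≤t
                     (<-≤-trans (∸-monoʳ-< (≤-<-trans z≤n Vi<Vi₁) Vi₁≤t) (proj₂ t-bounds))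
                     (λ q 1≤q q<i₁ Vi₁<Vq Vq≤t → noEarlier₁ q 1≤q q<i₁ (<-trans Vi<Vi₁ Vi₁<Vq) Vq≤t)
                     qt 1≤qt qt≤n Vqt≡t
          rest : List ℕ
          rest = proj₁ chased
          chain₁ : Chain i₁ rest
          chain₁ = proj₂ (proj₂ chased)
          chain : Chain i (i₁ ∷ rest)
          chain = next (≤-<-trans i≤c cj<i₁) i₁≤n Vi<Vi₁ noEarlier₁ chain₁
          rotation≡swaps : setMany π (i ∷ i₁ ∷ rest) (rotR (map V (i ∷ i₁ ∷ rest))) ≡ swapsAlong i (i₁ ∷ rest)
          rotation≡swaps = trans (cong (setMany π (i ∷ i₁ ∷ rest)) (rotR-cons (V i) (map V (i₁ ∷ rest))))
                                 (rotateAlong≡swapsAlong (s≤s z≤n) i≤n chain)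
          result : greedyStep n lam T j i π ≡ just (swapsAlong i (i₁ ∷ rest))
          result = begin
            greedyStep n lam T j i π                                                  ≡⟨ if-false changed ⟩
            (findFirst P (range (suc cj) n) >>= λ i₁ → chase n n π t i₁ >>= λ rest →
               just (setMany π (i ∷ i₁ ∷ rest) (rotR (map V (i ∷ i₁ ∷ rest)))))      ≡⟨ >>=-just _ found ⟩
            (chase n n π t i₁ >>= λ rest → just (setMany π (i ∷ i₁ ∷ rest) (rotR (map V (i ∷ i₁ ∷ rest)))))
                                                                                     ≡⟨ >>=-just _ (proj₁ (proj₂ chased)) ⟩
            just (setMany π (i ∷ i₁ ∷ rest) (rotR (map V (i ∷ i₁ ∷ rest))))          ≡⟨ cong just rotation≡swaps ⟩
            just (swapsAlong i (i₁ ∷ rest))                                           ∎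
            where open ≡-Reasoning

      module Rotated (ps : List ℕ) (chain : Chain i ps) (beyond : All (cj <_) ps) where
        π' : List ℕ
        π' = swapsAlong i ps

        off-chain : ∀ q → q ≤ cj → All (q ≢_) ps
        off-chain q q≤c = All<⇒All≢ (All.map (≤-<-trans q≤c) beyond)

        invariant' : Invariant i' π'
        invariant' = ↭-trans (swapsAlong-↭ (s≤s z≤n) i≤n chain) π↭ , upper' , lower'
          where
            upper' : ∀ p → 1 ≤ p → p ≤ i' → at π' p ≡ T jp p
            upper' p 1≤p p≤i' = trans (swapsAlong-untouched i ps p (<⇒≢ (s≤s p≤i')) (off-chain p (≤-trans p≤i' (≤-trans (n≤1+n i') i≤c))))
                                      (upper p 1≤p (≤-trans p≤i' (n≤1+n i')))
            lower' : ∀ p → i' < p → p ≤ cj → at π' p ≡ T j p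
            lower' p i'<p p≤c with m≤n⇒m<n∨m≡n i'<p
            ... | inj₂ refl = swapsAlong-start (s≤s z≤n) i≤n chain
            ... | inj₁ i<p  = trans (swapsAlong-untouched i ps p (<⇒≢ i<p ∘ sym) (off-chain p p≤c)) (lower p i<p p≤c)

        -- Let X fit column j with π ≼ X.  X carries t within its first c_j
        -- positions, so X strictly dominates π on prefixes k ≥ c_j and
        -- thresholds just below t, as long as π has no value in between.
        module Against (X : List ℕ) (fits : Fits j X) (π≼X : π ≼ X) where
          tX = fits-position j X (s≤s z≤n) fits i (s≤s z≤n) i≤c
          qX = proj₁ tX
          1≤qX = proj₁ (proj₂ tX)
          qX≤c = proj₁ (proj₂ (proj₂ tX))
          XqX≡t : at X qX ≡ t
          XqX≡t = proj₂ (proj₂ (proj₂ tX))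

          strict-beyond-column : ∀ a p k s → cj ≤ k → k < p → V a ≤ s → s < t → NoEarlierInWindow a p →
                                 exceed π k s < exceed X k s
          strict-beyond-column a p k s c≤k k<p Va≤s s<t noEarlier = begin-strict
            exceed π k s ≡⟨ exceed-flat π k s t (<⇒≤ s<t) gap ⟩
            exceed π k t ≤⟨ π≼X k t ⟩
            exceed X k t <⟨ exceed-strict X k qX s t 1≤qX (≤-trans qX≤c c≤k)
                              (subst (qX ≤_) (sym (perm-length n (proj₁ fits))) (≤-trans qX≤c (c≤n j)))
                              (subst (s <_) (sym XqX≡t) s<t) (≤-reflexive XqX≡t) (<⇒≤ s<t) ⟩
            exceed X k s ∎
            where
              open ≤-Reasoning
              gap : ∀ q → 1 ≤ q → q ≤ k → V q ≤ s ⊎ t < V q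
              gap q 1≤q q≤k with ≤-<-connex (V q) t
              ... | inj₂ t<Vq = inj₂ t<Vq
              ... | inj₁ Vq≤t with ≤-<-connex (V q) (V a)
              ...   | inj₁ Vq≤Va = inj₁ (≤-trans Vq≤Va Va≤s)
              ...   | inj₂ Va<Vq = ⊥-elim (noEarlier q 1≤q (≤-<-trans q≤k k<p) Va<Vq Vq≤t)

          -- inside the column: π has only small values in rows 1..i, while X
          -- has the large values of rows i..c_j of column j among its first c_j
          strict-inside-column : ∀ k s → i ≤ k → k < cj → V i ≤ s → s < t → exceed π k s < exceed X k s
          strict-inside-column k s i≤k k<c Vi≤s s<t = ≤-<-trans π-bound (+-cancelˡ-≤ (cj ∸ k) _ _ X-bound)
            where
              π-bound : exceed π k s ≤ k ∸ i
              π-bound = exceed-smallPrefix π k i s i≤k (λ q 1≤q q≤i _ → ≤-trans (upper-small q 1≤q q≤i) Vi≤s)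
              column-bound : suc (cj ∸ i) ≤ exceed (col j) cj s
              column-bound = exceed-largeSuffix (col j) cj i s (s≤s z≤n) i≤c (≤-reflexive (sym (length-col j)))
                (λ q i≤q q≤c → subst (s <_) (sym (at-col j q (≤-trans (s≤s z≤n) i≤q) q≤c))
                                 (<-≤-trans s<t (column-weak j i q (s≤s z≤n) (s≤s z≤n) i≤q q≤c)))
              X-bound : (cj ∸ k) + suc (k ∸ i) ≤ (cj ∸ k) + exceed X k s
              X-bound = begin
                (cj ∸ k) + suc (k ∸ i)   ≡⟨ +-suc (cj ∸ k) (k ∸ i) ⟩
                suc ((cj ∸ k) + (k ∸ i)) ≡⟨ cong suc (sym (∸-split cj k i i≤k (<⇒≤ k<c))) ⟩
                suc (cj ∸ i)            ≤⟨ column-bound ⟩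
                exceed (col j) cj s      ≡⟨ sym (fits-count j X (s≤s z≤n) fits s) ⟩
                exceed X cj s            ≤⟨ exceed-extend X k cj s (<⇒≤ k<c) ⟩
                exceed X k s + (cj ∸ k)  ≡⟨ +-comm (exceed X k s) (cj ∸ k) ⟩
                (cj ∸ k) + exceed X k s  ∎
                where open ≤-Reasoning

          strict-along : ∀ {a rs} → cj < a → Chain a rs → StrictlyBelowAlong X a rs
          strict-along c<a (arrived _) = tt
          strict-along {a} {p ∷ rs} c<a (next a<p _ _ noEarlier chain') =
            (λ k s a≤k k<p Va≤s s<t → strict-beyond-column a p k s (≤-trans (<⇒≤ c<a) a≤k) k<p Va≤s s<t noEarlier) ,
            strict-along (<-trans c<a a<p) chain'

          -- the first link starts inside the column, all later ones beyond it
          strict-chain : StrictlyBelowAlong X i ps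
          strict-chain = first-link chain beyond
            where
              first-link : ∀ {rs} → Chain i rs → All (cj <_) rs → StrictlyBelowAlong X i rs
              first-link (arrived _) _ = tt
              first-link {p ∷ rs} (next _ _ _ noEarlier chain') (cj<p ∷ _) = strict-link , strict-along cj<p chain'
                where
                  strict-link : StrictlyBelowOn X i p
                  strict-link k s i≤k k<p Vi≤s s<t with ≤-<-connex cj k
                  ... | inj₁ c≤k = strict-beyond-column i p k s c≤k k<p Vi≤s s<t noEarlier
                  ... | inj₂ k<c = strict-inside-column k s i≤k k<c Vi≤s s<t

          stays-below : π' ≼ X
          stays-below = swapsAlong-below X π≼X (s≤s z≤n) i≤n chain strict-chain

        progress : Progress i' π π'
        progress = invariant' , swapsAlong-bruhat (s≤s z≤n) i≤n chain , λ X fits π≼X → Against.stays-below X fits π≼X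

    stage : ∀ i' → suc i' ≤ cj → ∀ π → Invariant (suc i') π →
            Σ (List ℕ) λ π' → greedyStep n lam T j (suc i') π ≡ just π' × Progress i' π π'
    stage i' i≤c π inv = by-comparison (T jp (suc i') ≡ᵇ T j (suc i')) refl
      where
        by-comparison : ∀ b → (T jp (suc i') ≡ᵇ T j (suc i')) ≡ b →
                       Σ (List ℕ) λ π' → greedyStep n lam T j (suc i') π ≡ just π' × Progress i' π π'
        by-comparison true  same = π , if-true same ,
          unchanged-step i' i≤c π inv (≡ᵇ⇒≡ _ _ (subst True (sym same) tt)) , ε , λ _ _ π≼X → π≼X
        by-comparison false changed = Rotated.π' ps chain beyond , result , Rotated.progress ps chain beyond
          where
            open MoveStep i' i≤c π inv changed
            ps = proj₁ chain-found
            result = proj₁ (proj₂ chain-found)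
            chain = proj₁ (proj₂ (proj₂ chain-found))
            beyond = proj₂ (proj₂ (proj₂ chain-found))

    run : ∀ i → i ≤ cj → ∀ π → Invariant i π →
          Σ (List ℕ) λ π' → runRows n lam T j (applyDownFrom (1 +_) i) π ≡ just π' × Progress 0 π π'
    run zero     _   π inv = π , refl , inv , ε , λ _ _ π≼X → π≼X
    run (suc i') i≤c π inv =
      let π₁ , ran₁ , inv₁ , π≤π₁ , below₁ = stage i' i≤c π inv
          π₂ , ran₂ , inv₂ , π₁≤π₂ , below₂ = run i' (≤-trans (n≤1+n i') i≤c) π₁ inv₁
      in π₂ , trans (>>=-just (runRows n lam T j (applyDownFrom (1 +_) i')) ran₁) ran₂ , inv₂ , π≤π₁ ◅◅ π₁≤π₂ ,
         λ X fits π≼X → below₂ X fits (below₁ X fits π≼X)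

    column-stage : ∀ π → ShowsColumn jp π →
                   Σ (List ℕ) λ π' → runRows n lam T j (reverse (range 1 cj)) π ≡ just π' ×
                                     ShowsColumn j π' × π ≤B π' × (∀ X → Fits j X → π ≼ X → π' ≼ X)
    column-stage π (π↭ , shows) =
      let π' , ran , (π'↭ , _ , lower) , π≤π' , below =
            run cj ≤-refl π (π↭ , (λ p 1≤p p≤c → shows p 1≤p (≤-trans p≤c (c-antitone jp))) ,
                                  (λ p c<p p≤c → ⊥-elim (<⇒≱ c<p p≤c)))
      in π' , trans (cong (λ rows → runRows n lam T j rows π) (reverse-applyUpTo (1 +_) cj)) ran ,
         (π'↭ , λ p 1≤p p≤c → lower p 1≤p p≤c) , π≤π' , below

  -- The first column: π^(1,1) lists column 1 and then the remaining values,
  -- both increasingly, and is therefore below every X that fits column 1.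

  C₁ : List ℕ
  C₁ = col 1

  inC₁ : ℕ → Bool
  inC₁ x = any (λ y → x ≡ᵇ y) C₁

  D₁ : List ℕ
  D₁ = filterᵇ (not ∘ inC₁) (range 1 n)

  inC₁⁻ : ∀ x → True (inC₁ x) → x ∈ C₁
  inC₁⁻ x found = Any.map (λ {y} → ≡ᵇ⇒≡ x y) (any⁻ (λ y → x ≡ᵇ y) C₁ found)

  inC₁⁺ : ∀ x → x ∈ C₁ → True (inC₁ x)
  inC₁⁺ x x∈ = any⁺ (λ y → x ≡ᵇ y) (Any.map (λ {y} → ≡⇒≡ᵇ x y) x∈)

  ∈D₁⁻ : ∀ {y} → y ∈ D₁ → y ∈ range 1 n × y ∉ C₁
  ∈D₁⁻ {y} y∈ = let y∈range , notIn = ∈-filter⁻ (T? ∘ (not ∘ inC₁)) y∈ in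
    y∈range , λ y∈C₁ → subst True (Equivalence.to T-not-≡ notIn) (inC₁⁺ y y∈C₁)

  ∈D₁⁺ : ∀ {y} → y ∈ range 1 n → y ∉ C₁ → y ∈ D₁
  ∈D₁⁺ {y} y∈range y∉C₁ = ∈-filter⁺ (T? ∘ (not ∘ inC₁)) y∈range (Equivalence.from T-not-≡ notIn)
    where
      notIn : inC₁ y ≡ false
      notIn with inC₁ y in eq
      ... | true  = ⊥-elim (y∉C₁ (inC₁⁻ y (subst True (sym eq) tt)))
      ... | false = refl

  C₁-increasing : Increasing C₁
  C₁-increasing = col-increasing 1 ≤-refl

  D₁-increasing : Increasing D₁
  D₁-increasing = AllPairsₚ.filter⁺ (T? ∘ (not ∘ inC₁)) (range-increasing 1 n)

  pi11-↭ : pi11 n lam T ↭ range 1 n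
  pi11-↭ = sameMembers⇒↭ unique (Increasing⇒Unique (range-increasing 1 n)) forth back
    where
      unique : Unique (C₁ ++ D₁)
      unique = AllPairsₚ.++⁺ (Increasing⇒Unique C₁-increasing) (Increasing⇒Unique D₁-increasing)
                 (All.tabulate λ x∈C₁ → All.tabulate λ y∈D₁ x≡y → proj₂ (∈D₁⁻ y∈D₁) (subst (_∈ C₁) x≡y x∈C₁))
      forth : (C₁ ++ D₁) ⊆ range 1 n
      forth y∈ with ∈-++⁻ C₁ y∈
      ... | inj₂ y∈D₁ = proj₁ (∈D₁⁻ y∈D₁)
      ... | inj₁ y∈C₁ with ∈⇒at C₁ y∈C₁
      ...   | p , 1≤p , p≤len , refl =
        let p≤c = subst (p ≤_) (length-col 1) p≤len
            bounds = entry-bounds 1 p ≤-refl 1≤p p≤c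
        in subst (_∈ range 1 n) (sym (at-col 1 p 1≤p p≤c)) (∈-range1⁺ n (proj₁ bounds) (proj₂ bounds))
      back : range 1 n ⊆ (C₁ ++ D₁)
      back {y} y∈ with inC₁ y in eq
      ... | true  = ∈-++⁺ˡ (inC₁⁻ y (subst True (sym eq) tt))
      ... | false = ∈-++⁺ʳ C₁ (∈D₁⁺ y∈ λ y∈C₁ → subst True eq (inC₁⁺ y y∈C₁))

  pi11-shows : ShowsColumn 1 (pi11 n lam T)
  pi11-shows = pi11-↭ , λ p 1≤p p≤c → trans (at-++ˡ C₁ D₁ p (subst (p ≤_) (sym (length-col 1)) p≤c)) (at-col 1 p 1≤p p≤c)

  pi11-least : ∀ X → Fits 1 X → pi11 n lam T ≼ X
  pi11-least X fits k s = [ bounded k , saturated ]′ (≤-<-connex k n)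
    where
      X↭ = proj₁ fits
      lenX = perm-length n X↭
      uniqueX = perm-unique n X↭
      c₁ = c 1
      bounded : ∀ k → k ≤ n → exceed (pi11 n lam T) k s ≤ exceed X k s
      bounded k k≤n with ≤-<-connex k c₁
      -- within the first column: C₁ is increasing and the first c₁ entries of X are those of C₁
      ... | inj₁ k≤c = subst₂ _≤_ (cong (count (above s)) (sym (take-++ˡ k C₁ D₁ (subst (k ≤_) (sym (length-col 1)) k≤c))))
                                  (sym (exceed-take X k c₁ s k≤c))
        (increasing-least C₁ (take c₁ X) k s C₁-increasing (AllPairsₚ.take⁺ c₁ uniqueX)
                          (λ y∈ → ∈-resp-↭ (fits-take 1 X ≤-refl fits) y∈)
                          (subst (k ≤_) (sym (length-take≡ c₁ X (subst (c₁ ≤_) (sym lenX) (c≤n 1)))) k≤c))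

      -- beyond it: both count C₁ fully; then D₁ is increasing and the rest of X avoids C₁
      ... | inj₂ c<k = subst₂ _≤_ (sym pi11-split) (sym X-split) (+-monoʳ-≤ (exceed C₁ c₁ s) rest-bound)
        where
          m = k ∸ c₁
          k≡ : k ≡ c₁ + m
          k≡ = sym (m+[n∸m]≡n (<⇒≤ c<k))
          pi11-split : exceed (pi11 n lam T) k s ≡ exceed C₁ c₁ s + exceed D₁ m s
          pi11-split = trans (cong (λ z → exceed (C₁ ++ D₁) z s) k≡)
            (trans (exceed-split (C₁ ++ D₁) c₁ m s)
                   (cong₂ _+_ (cong (count (above s)) (take-++ˡ c₁ C₁ D₁ (≤-reflexive (sym (length-col 1)))))
                              (cong (λ z → exceed z m s) (subst (λ z → drop z (C₁ ++ D₁) ≡ D₁) (length-col 1) (drop-++ˡ C₁ D₁)))))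
          X-split : exceed X k s ≡ exceed C₁ c₁ s + exceed (drop c₁ X) m s
          X-split = trans (cong (λ z → exceed X z s) k≡)
            (trans (exceed-split X c₁ m s) (cong (_+ exceed (drop c₁ X) m s) (fits-count 1 X ≤-refl fits s)))
          rest-bound : exceed D₁ m s ≤ exceed (drop c₁ X) m s
          rest-bound = increasing-least D₁ (drop c₁ X) m s D₁-increasing (AllPairsₚ.drop⁺ c₁ uniqueX)
            (λ {y} y∈ → ∈D₁⁺ (∈-resp-↭ X↭ (∈-drop c₁ X y∈))
                             (λ y∈C₁ → take-drop-disjoint c₁ X uniqueX (∈-resp-↭ (↭-sym (fits-take 1 X ≤-refl fits)) y∈C₁) y∈))
            (subst (m ≤_) (sym (trans (length-drop c₁ X) (cong (_∸ c₁) lenX))) (∸-monoˡ-≤ c₁ k≤n))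

      -- prefixes longer than n count the whole list
      saturated : n < k → exceed (pi11 n lam T) k s ≤ exceed X k s
      saturated n<k = subst₂ _≤_ (sym (saturate (pi11 n lam T) (perm-length n pi11-↭))) (sym (saturate X lenX)) (bounded n ≤-refl)
        where
          saturate : ∀ u → length u ≡ n → exceed u k s ≡ exceed u n s
          saturate u len = trans (exceed-full u k s (≤-trans (≤-reflexive len) (<⇒≤ n<k))) (sym (exceed-full u n s (≤-reflexive len)))

module GreedyChain (n : ℕ) (lam : ℕ → ℕ) (isP : IsPartition n lam) (T : ℕ → ℕ → ℕ) (ssyt : IsSSYT n lam T) where
  open Tableau n lam isP T ssyt

  -- the greedy chain π^(j,1), as a total function
  P : ℕ → List ℕ
  P j = fromMaybe [] (greedyPi n lam T j 1)

  column-step : ∀ k → greedyPi n lam T (suc k) 1 ≡ just (P (suc k)) → ShowsColumn (suc k) (P (suc k)) →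
                greedyPi n lam T (suc (suc k)) 1 ≡ just (P (suc (suc k))) × ShowsColumn (suc (suc k)) (P (suc (suc k))) ×
                P (suc k) ≤B P (suc (suc k)) × (∀ X → Fits (suc (suc k)) X → P (suc k) ≼ X → P (suc (suc k)) ≼ X)
  column-step k computed shows =
    let π' , ran , shows' , π≤π' , below = GreedyColumn.column-stage (suc k) (s≤s z≤n) (P (suc k)) shows
        result : greedyPi n lam T (suc (suc k)) 1 ≡ just π'
        result = trans (>>=-just _ computed) ran
        P≡ : P (suc (suc k)) ≡ π'
        P≡ = cong (fromMaybe []) result
    in trans result (cong just (sym P≡)) , subst (ShowsColumn (suc (suc k))) (sym P≡) shows' ,
       subst (P (suc k) ≤B_) (sym P≡) π≤π' , λ X fits P≼X → subst (_≼ X) (sym P≡) (below X fits P≼X)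

  greedy-computed : ∀ j → 1 ≤ j → greedyPi n lam T j 1 ≡ just (P j) × ShowsColumn j (P j)
  greedy-computed (suc zero)    _ = refl , pi11-shows
  greedy-computed (suc (suc k)) _ =
    let computed , shows = greedy-computed (suc k) (s≤s z≤n)
        computed' , shows' , _ = column-step k computed shows
    in computed' , shows'

  greedy-step : ∀ k → P (suc k) ≤B P (suc (suc k)) × (∀ X → Fits (suc (suc k)) X → P (suc k) ≼ X → P (suc (suc k)) ≼ X)
  greedy-step k = let computed , shows = greedy-computed (suc k) (s≤s z≤n) in proj₂ (proj₂ (column-step k computed shows))

  greedy-defining : IsDefiningChain n lam T P
  greedy-defining = (λ j 1≤j _ → proj₁ (proj₂ (greedy-computed j 1≤j))) ,
                    (λ { (suc k) _ _ → proj₁ (greedy-step k) }) ,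
                    (λ j 1≤j _ → proj₂ (showsColumn⇒fits j (P j) (proj₂ (greedy-computed j 1≤j))))

  -- by minimality w ≼ P, and by the stage-wise leastness of P also P ≼ w
  minimal-is-greedy : ∀ w → IsMinimalDefiningChain n lam T w → ∀ j → 1 ≤ j → j ≤ lam 1 → w j ≡ P j
  minimal-is-greedy w (w-defining , w-minimal) j 1≤j j≤λ =
    ≼-antisym (w j) (P j) (≤B⇒≼ (w-minimal P greedy-defining j 1≤j j≤λ)) (P≼w j 1≤j j≤λ)
      (trans (perm-length n (proj₁ w-defining j 1≤j j≤λ)) (sym (perm-length n (proj₁ (proj₂ (greedy-computed j 1≤j))))))
    where
      w-fits : ∀ j → 1 ≤ j → j ≤ lam 1 → Fits j (w j)
      w-fits j 1≤j j≤λ = proj₁ w-defining j 1≤j j≤λ , proj₂ (proj₂ w-defining) j 1≤j j≤λ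
      P≼w : ∀ j → 1 ≤ j → j ≤ lam 1 → P j ≼ w j
      P≼w (suc zero)    1≤j j≤λ = pi11-least (w 1) (w-fits 1 1≤j j≤λ)
      P≼w (suc (suc k)) 1≤j j≤λ = proj₂ (greedy-step k) (w (suc (suc k))) (w-fits (suc (suc k)) 1≤j j≤λ)
        (≼-trans (≼-reflexive (sym (minimal-is-greedy w (w-defining , w-minimal) (suc k) (s≤s z≤n) (≤-trans (n≤1+n _) j≤λ))))
                 (≤B⇒≼ (proj₁ (proj₂ w-defining) (suc k) (s≤s z≤n) j≤λ)))

mainTheorem3 : (n : ℕ) → 2 ≤ n → (lam : ℕ → ℕ) → IsPartition n lam →
               1 ≤ lam 1 → lam n ≡ 0 →
               (T : ℕ → ℕ → ℕ) → IsSSYT n lam T →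
               (w : ℕ → List ℕ) → IsMinimalDefiningChain n lam T w →
               ∀ j → 1 ≤ j → j ≤ lam 1 → greedyPi n lam T j 1 ≡ just (w j)
mainTheorem3 n _ lam isP _ _ T ssyt w minimal j 1≤j j≤λ =
  trans (proj₁ (greedy-computed j 1≤j)) (cong just (sym (minimal-is-greedy w minimal j 1≤j j≤λ)))
  where open GreedyChain n lam isP T ssyt
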